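{- Let $p$ be an odd prime and let $n$ be a positive integer. Let $b(2n)$, $d(2n)$, $\widehat{\beta}(2n)$ be the denominators (in lowest terms) of $B_{2n}$, $D_{2n}^{(1)}$ and $\widehat{D}_{2n}^{(1)}$, respectively. Then \[ \mathrm{ord}_p(d(2n))=\mathrm{ord}_p(\widehat{\beta}(2n))=\mathrm{ord}_p(b(2n)). \]
   Context: The Bernoulli numbers $B_n$ are defined by $t/(e^t-1)=\sum_{n\ge0}B_nt^n/n!$. For $k\in\mathbb{Z}$ and $|z|<1$, let $\mathrm{Li}_k(z)=\sum_{n\ge1}z^n/n^k$ and $\mathrm{A}_k(z)=\mathrm{Li}_k(z)-\mathrm{Li}_k(-z)$. In particular $\mathrm{A}_1(z)=2\tanh^{ -1}(z)$. The polycosecant numbers $D_n^{(k)}$ are defined by \[ \frac{\mathrm{A}_k(\tanh(t/2))}{\sinh t}=\sum_{n\ge0}D_n^{(k)}\frac{t^n}{n!}, \] and the polycotangent numbers $\widehat{D}_n^{(k)}$ are defined by \[ \frac{\mathrm{A}_k(\tanh(t/2))}{\tanh t}=\sum_{n\ge0}\widehat{D}_n^{(k)}\frac{t^n}{n!}. \] The symbol $\mathrm{ord}_p$ denotes the $p$-adic valuation. -}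

module Defs where

open import Data.Nat as ℕ using (ℕ; zero; suc; _!; _∸_)
open import Data.Nat.Properties using (_!≢0)
open import Data.Nat.Divisibility using (_∣?_)
open import Data.Integer as ℤ using (ℤ; +_; -[1+_])
open import Data.Rational as ℚ using (ℚ; 0ℚ; 1ℚ; ½; _+_; _*_; _-_; -_; _/_)
open import Relation.Nullary using (yes; no)

Series : Set
Series = ℕ → ℚ

sumTo : ℕ → (ℕ → ℚ) → ℚ
sumTo zero    f = f 0
sumTo (suc n) f = sumTo n f + f (suc n)

_^ℚ_ : ℚ → ℕ → ℚ
q ^ℚ zero  = 1ℚ
q ^ℚ suc n = q * (q ^ℚ n)

sgn : ℕ → ℚ
sgn n = (- 1ℚ) ^ℚ n

oneS : Series
oneS zero    = 1ℚ
oneS (suc _) = 0ℚ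

tS : Series
tS 1 = 1ℚ
tS _ = 0ℚ

addS subS : Series → Series → Series
addS f g n = f n + g n
subS f g n = f n - g n

mulS : Series → Series → Series
mulS f g n = sumTo n (λ i → f i * g (n ∸ i))

powS : Series → ℕ → Series
powS g zero    = oneS
powS g (suc k) = mulS g (powS g k)

-- composition f(g(t)), meaningful when g has zero constant term
compS : Series → Series → Series
compS f g n = sumTo n (λ k → f k * powS g k n)

scaleS : ℚ → Series → Series
scaleS c f n = f n * (c ^ℚ n)

-- f(t) / t  (for f with zero constant term)
shiftS : Series → Series
shiftS f n = f (suc n)

-- 1 / f for f with constant term 1:  1/(1 - h) = Σ_k h^k with h = 1 - f
inv1S : Series → Series
inv1S f = compS (λ _ → 1ℚ) (subS oneS f)

-- F / G for F with zero constant term and G = t + O(t^2)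
--   F / G = (F/t) / (G/t)
divS : Series → Series → Series
divS F G = mulS (shiftS F) (inv1S (shiftS G))

invFact : ℕ → ℚ
invFact n = (+ 1 / (n !)) {{n !≢0}}

expS : Series
expS = invFact

-- sinh t = (e^t - e^{-t})/2 ,  cosh t = (e^t + e^{-t})/2
sinhS coshS tanhS : Series
sinhS n = ½ * ((1ℚ - sgn n) * invFact n)
coshS n = ½ * ((1ℚ + sgn n) * invFact n)
tanhS = mulS sinhS (inv1S coshS)

-- Li_k(z) = Σ_{n≥1} z^n / n^k , k ∈ ℤ
LiS : ℤ → Series
LiS k zero = 0ℚ
LiS (+ j)      (suc m) = ((+ 1) / suc m) ^ℚ j
LiS -[1+ j ]   (suc m) = ((+ suc m) / 1) ^ℚ suc j

-- A_k(z) = Li_k(z) - Li_k(-z)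
AS : ℤ → Series
AS k n = LiS k n - sgn n * LiS k n

egfCoeff : Series → ℕ → ℚ
egfCoeff F n = ((+ (n !)) / 1) * F n

-- Bernoulli numbers:  t / (e^t - 1) = Σ B_n t^n / n!
bernoulli : ℕ → ℚ
bernoulli = egfCoeff (divS tS (subS expS oneS))

-- polycosecant numbers: A_k(tanh(t/2)) / sinh t = Σ D_n^{(k)} t^n / n!
polycosecant : ℤ → ℕ → ℚ
polycosecant k = egfCoeff (divS (compS (AS k) (scaleS ½ tanhS)) sinhS)

-- polycotangent numbers: A_k(tanh(t/2)) / tanh t = Σ D̂_n^{(k)} t^n / n!
polycotangent : ℤ → ℕ → ℚ
polycotangent k = egfCoeff (divS (compS (AS k) (scaleS ½ tanhS)) tanhS)

-- p-adic valuation of a natural number (ord_p 0 is set to 0; only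
-- applied to positive denominators here).  Fuel m suffices for p ≥ 2.

ord : ℕ → ℕ → ℕ
ord zero    m = 0
ord (suc q) m = go m m
  where
  go : ℕ → ℕ → ℕ
  go zero       _ = 0
  go (suc fuel) zero = 0
  go (suc fuel) (suc k) with suc q ∣? suc k
  ... | yes _ = suc (go fuel (suc k ℕ./ suc q))
  ... | no  _ = 0

den : ℚ → ℕ
den = ℚ.denominatorℕ

{-# OPTIONS --safe #-}
-- With B(t) = t / (e^t - 1) = Σ B_N t^N / N!, the identity A₁(tanh(t/2)) = t turns the two generating
-- functions into t / tanh t = B(2t) + t and t / sinh t = 2 B(t) - B(2t), so that for N ≥ 2
-- D̂_N = 2^N B_N and D_N = (2 - 2^N) B_N.  Expanding t / (e^t - 1) as log(1 + x) / x at x = e^t - 1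
-- writes B_N through Stirling numbers and shows that p B_N is p-integral, so ord_p of the denominator
-- of B_N is 0 or 1 and is unchanged by factors prime to p, such as 2^N.  The Genocchi numbers
-- 2 (1 - 2^N) B_N, the coefficients of 2t / (e^t + 1), are integers: if p divides the denominator
-- of B_N then p ∣ 2^N - 1, so p ∤ 2^N - 2.
module Submission where

open import Defs

-- The ℚ operators used throughout would clash with the ℕ operators of the statement at the end.
module _ where

  open import Algebra.Bundles using (CommutativeRing)
  import Algebra.Solver.Ring
  open import Algebra.Structures using (IsCommutativeRing)
  open import Algebra.Solver.Ring.AlmostCommutativeRing using (fromCommutativeRing; _-Raw-AlmostCommutative⟶_)
  open import Data.Empty using (⊥-elim)
  open import Data.Integer as ℤ using (ℤ)
  import Data.Integer.Properties as ℤ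
  open import Data.Integer.GCD using (gcd)
  open import Data.Integer.Solver using () renaming (module +-*-Solver to ℤ-Solver)
  open import Data.Maybe using (Maybe; just; nothing)
  open import Data.Nat as ℕ using (ℕ; zero; suc; _!; _∸_; _^_; _≤_; _<_; z≤n; s≤s; _%_)
  import Data.Nat.Properties as ℕ
  import Data.Nat.Coprimality as Coprimality
  open import Data.Nat.DivMod using (m/n*n≡m)
  open import Data.Nat.Solver using () renaming (module +-*-Solver to ℕ-Solver)
  open import Data.Nat.Combinatorics using (k![n∸k]!∣n!)
  open import Data.Nat.Divisibility
    using ( _∣_; divides; quotient; _∣?_; _∣0; ∣-trans; ∣1⇒≡1; ∣⇒≤; m∣m*n; ∣n⇒∣m*n; m*n∣⇒n∣; ∣m+n∣m⇒∣n
          ; m∣n⇒n≡quotient*m; *-monoˡ-∣; *-monoʳ-∣; *-cancelˡ-∣; m≤n⇒m!∣n!)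
  open import Data.Nat.Primality
    using ( Prime; Composite; composite; prime?; euclidsLemma; ¬prime[0]; ¬prime[1]
          ; prime⇒nonZero; ¬prime⇒composite; prime⇒irreducible)
  open import Data.Product using (Σ; _,_)
  open import Data.Sum using (inj₁; inj₂; [_,_]′)
  open import Data.Rational as ℚ using (ℚ; 0ℚ; 1ℚ; ½; _+_; _*_; _-_; -_; _/_; ↥_; ↧_)
  open import Data.Rational.Properties
  import Data.Rational.Unnormalised as ℚᵘ
  import Data.Rational.Unnormalised.Properties as ℚᵘ
  open import Data.Rational.Solver using () renaming (module +-*-Solver to ℚ-Solver)
  open import Relation.Binary.Definitions using (tri<; tri≈; tri>)
  open import Relation.Binary.PropositionalEquality
  open import Relation.Nullary using (¬_; yes; no)
  open import Relation.Nullary.Decidable using (recompute)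

  fromℤ : ℤ → ℚ
  fromℤ a = a / 1

  fromℕ : ℕ → ℚ
  fromℕ n = fromℤ (ℤ.+ n)

  1/[1+_] : ℕ → ℚ
  1/[1+ n ] = ℤ.+ 1 / suc n

  toℚᵘ-/ : ∀ a n → ℚ.toℚᵘ (a / suc n) ℚᵘ.≃ ℚᵘ.mkℚᵘ a n
  toℚᵘ-/ a n = ℚᵘ.*≡* (begin
      ℚᵘ.↥ (ℚ.toℚᵘ x) ℤ.* ℤ.+ suc n ≡⟨ cong (ℤ._* ℤ.+ suc n) (↥ᵘ-toℚᵘ x) ⟩
      ↥ x ℤ.* ℤ.+ suc n             ≡⟨ cong (↥ x ℤ.*_) (↧-/ a (suc n)) ⟨
      ↥ x ℤ.* (↧ x ℤ.* g)           ≡⟨ solve 3 (λ u v w → u :* (v :* w) := (u :* w) :* v) refl (↥ x) (↧ x) g ⟩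
      (↥ x ℤ.* g) ℤ.* ↧ x           ≡⟨ cong (ℤ._* ↧ x) (↥-/ a (suc n)) ⟩
      a ℤ.* ↧ x                     ≡⟨ cong (a ℤ.*_) (↧ᵘ-toℚᵘ x) ⟨
      a ℤ.* ℚᵘ.↧ (ℚ.toℚᵘ x)         ∎)
    where
    open ≡-Reasoning
    open ℤ-Solver
    x = a / suc n
    g = gcd a (ℤ.+ suc n)

  /-≡ : ∀ a b c d → a ℤ.* ℤ.+ suc d ≡ c ℤ.* ℤ.+ suc b → a / suc b ≡ c / suc d
  /-≡ a b c d eq = toℚᵘ-injective
    (ℚᵘ.≃-trans (toℚᵘ-/ a b) (ℚᵘ.≃-trans (ℚᵘ.*≡* eq) (ℚᵘ.≃-sym (toℚᵘ-/ c d))))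

  /-*-/ : ∀ a b c d → (a / suc b) * (c / suc d) ≡ (a ℤ.* c) / (suc b ℕ.* suc d)
  /-*-/ a b c d = toℚᵘ-injective (ℚᵘ.≃-trans (toℚᵘ-homo-* (a / suc b) (c / suc d))
    (ℚᵘ.≃-trans (ℚᵘ.*-cong (toℚᵘ-/ a b) (toℚᵘ-/ c d)) (ℚᵘ.≃-sym (toℚᵘ-/ (a ℤ.* c) _))))

  /-+-/ : ∀ a b c d → (a / suc b) + (c / suc d) ≡ (a ℤ.* ℤ.+ suc d ℤ.+ c ℤ.* ℤ.+ suc b) / (suc b ℕ.* suc d)
  /-+-/ a b c d = toℚᵘ-injective (ℚᵘ.≃-trans (toℚᵘ-homo-+ (a / suc b) (c / suc d))
    (ℚᵘ.≃-trans (ℚᵘ.+-cong (toℚᵘ-/ a b) (toℚᵘ-/ c d)) (ℚᵘ.≃-sym (toℚᵘ-/ _ _))))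

  -‿/ : ∀ a b → - (a / suc b) ≡ (ℤ.- a) / suc b
  -‿/ a b = toℚᵘ-injective (ℚᵘ.≃-trans (toℚᵘ-homo‿- (a / suc b))
    (ℚᵘ.≃-trans (ℚᵘ.-‿cong (toℚᵘ-/ a b)) (ℚᵘ.≃-sym (toℚᵘ-/ (ℤ.- a) b))))

  fromℤ-+ : ∀ a b → fromℤ (a ℤ.+ b) ≡ fromℤ a + fromℤ b
  fromℤ-+ a b = sym (trans (/-+-/ a 0 b 0) (/-≡ (a ℤ.* ℤ.+ 1 ℤ.+ b ℤ.* ℤ.+ 1) 0 (a ℤ.+ b) 0
    (solve 2 (λ u v → (u :* con (ℤ.+ 1) :+ v :* con (ℤ.+ 1)) :* con (ℤ.+ 1) := (u :+ v) :* con (ℤ.+ 1)) refl a b)))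
    where open ℤ-Solver

  fromℤ-* : ∀ a b → fromℤ (a ℤ.* b) ≡ fromℤ a * fromℤ b
  fromℤ-* a b = sym (/-*-/ a 0 b 0)

  fromℤ-neg : ∀ a → fromℤ (ℤ.- a) ≡ - fromℤ a
  fromℤ-neg a = sym (-‿/ a 0)

  fromℕ-+ : ∀ m n → fromℕ (m ℕ.+ n) ≡ fromℕ m + fromℕ n
  fromℕ-+ m n = fromℤ-+ (ℤ.+ m) (ℤ.+ n)

  fromℕ-* : ∀ m n → fromℕ (m ℕ.* n) ≡ fromℕ m * fromℕ n
  fromℕ-* m n = trans (cong fromℤ (ℤ.pos-* m n)) (fromℤ-* (ℤ.+ m) (ℤ.+ n))

  fromℕ-suc : ∀ n → fromℕ (suc n) ≡ 1ℚ + fromℕ n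
  fromℕ-suc = fromℕ-+ 1

  fromℕ-suc*1/[1+n] : ∀ n → fromℕ (suc n) * 1/[1+ n ] ≡ 1ℚ
  fromℕ-suc*1/[1+n] n = trans (/-*-/ (ℤ.+ suc n) 0 (ℤ.+ 1) n) (/-≡ (ℤ.+ suc n ℤ.* ℤ.+ 1) (n ℕ.+ 0) (ℤ.+ 1) 0
    (trans (ℤ.*-identityʳ _) (trans (ℤ.*-identityʳ _)
      (sym (trans (ℤ.*-identityˡ _) (cong (λ m → ℤ.+ suc m) (ℕ.+-identityʳ n)))))))

  fromℕ-suc-cancel : ∀ n {a b} → fromℕ (suc n) * a ≡ fromℕ (suc n) * b → a ≡ b
  fromℕ-suc-cancel n {a} {b} eq = begin
    a                                   ≡⟨ *-identityˡ a ⟨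
    1ℚ * a                              ≡⟨ cong (_* a) inverse ⟨
    1/[1+ n ] * fromℕ (suc n) * a       ≡⟨ *-assoc 1/[1+ n ] _ a ⟩
    1/[1+ n ] * (fromℕ (suc n) * a)     ≡⟨ cong (1/[1+ n ] *_) eq ⟩
    1/[1+ n ] * (fromℕ (suc n) * b)     ≡⟨ *-assoc 1/[1+ n ] _ b ⟨
    1/[1+ n ] * fromℕ (suc n) * b       ≡⟨ cong (_* b) inverse ⟩
    1ℚ * b                              ≡⟨ *-identityˡ b ⟩
    b                                   ∎
    where
    open ≡-Reasoning
    inverse : 1/[1+ n ] * fromℕ (suc n) ≡ 1ℚ
    inverse = trans (*-comm 1/[1+ n ] _) (fromℕ-suc*1/[1+n] n)

  invFact-suc : ∀ n → invFact (suc n) ≡ 1/[1+ n ] * invFact n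
  invFact-suc n = sym (1/[1+n]*1/m (n !) {{n ℕ.!≢0}})
    where
    1/[1+n]*1/m : ∀ m .{{_ : ℕ.NonZero m}} → 1/[1+ n ] * (ℤ.+ 1 / m) ≡ (ℤ.+ 1 / (suc n ℕ.* m)) {{ℕ.m*n≢0 (suc n) m}}
    1/[1+n]*1/m (suc k) = /-*-/ (ℤ.+ 1) n (ℤ.+ 1) k

  n!*invFact≡1 : ∀ n → fromℕ (n !) * invFact n ≡ 1ℚ
  n!*invFact≡1 n = m*1/m (n !) {{n ℕ.!≢0}}
    where
    m*1/m : ∀ m .{{_ : ℕ.NonZero m}} → fromℕ m * (ℤ.+ 1 / m) ≡ 1ℚ
    m*1/m (suc k) = fromℕ-suc*1/[1+n] k

  sumTo-cong≤ : ∀ n {f g : ℕ → ℚ} → (∀ i → i ≤ n → f i ≡ g i) → sumTo n f ≡ sumTo n g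
  sumTo-cong≤ zero    eq = eq 0 z≤n
  sumTo-cong≤ (suc n) eq =
    cong₂ _+_ (sumTo-cong≤ n (λ i i≤n → eq i (ℕ.m≤n⇒m≤1+n i≤n))) (eq (suc n) ℕ.≤-refl)

  sumTo-cong : ∀ n {f g : ℕ → ℚ} → (∀ i → f i ≡ g i) → sumTo n f ≡ sumTo n g
  sumTo-cong n eq = sumTo-cong≤ n (λ i _ → eq i)

  sumTo-zero : ∀ n {f : ℕ → ℚ} → (∀ i → i ≤ n → f i ≡ 0ℚ) → sumTo n f ≡ 0ℚ
  sumTo-zero zero    eq = eq 0 z≤n
  sumTo-zero (suc n) eq =
    cong₂ _+_ (sumTo-zero n (λ i i≤n → eq i (ℕ.m≤n⇒m≤1+n i≤n))) (eq (suc n) ℕ.≤-refl)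

  sumTo-+ : ∀ n (f g : ℕ → ℚ) → sumTo n (λ i → f i + g i) ≡ sumTo n f + sumTo n g
  sumTo-+ zero    f g = refl
  sumTo-+ (suc n) f g = trans (cong (_+ (f (suc n) + g (suc n))) (sumTo-+ n f g))
    (solve 4 (λ a b c d → (a :+ b) :+ (c :+ d) := (a :+ c) :+ (b :+ d)) refl
      (sumTo n f) (sumTo n g) (f (suc n)) (g (suc n)))
    where open ℚ-Solver

  sumTo-*ˡ : ∀ n c (f : ℕ → ℚ) → c * sumTo n f ≡ sumTo n (λ i → c * f i)
  sumTo-*ˡ zero    c f = refl
  sumTo-*ˡ (suc n) c f =
    trans (*-distribˡ-+ c (sumTo n f) (f (suc n))) (cong (_+ c * f (suc n)) (sumTo-*ˡ n c f))

  sumTo-*ʳ : ∀ n c (f : ℕ → ℚ) → sumTo n f * c ≡ sumTo n (λ i → f i * c)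
  sumTo-*ʳ n c f = trans (*-comm _ c) (trans (sumTo-*ˡ n c f) (sumTo-cong n (λ i → *-comm c (f i))))

  sumTo-neg : ∀ n (f : ℕ → ℚ) → - sumTo n f ≡ sumTo n (λ i → - f i)
  sumTo-neg zero    f = refl
  sumTo-neg (suc n) f =
    trans (neg-distrib-+ (sumTo n f) (f (suc n))) (cong (_+ - f (suc n)) (sumTo-neg n f))

  sumTo-unfoldˡ : ∀ n (f : ℕ → ℚ) → sumTo (suc n) f ≡ f 0 + sumTo n (λ i → f (suc i))
  sumTo-unfoldˡ zero    f = refl
  sumTo-unfoldˡ (suc n) f = trans (cong (_+ f (2 ℕ.+ n)) (sumTo-unfoldˡ n f)) (+-assoc (f 0) _ _)

  sumTo-extend : ∀ {i n} {f : ℕ → ℚ} → i ≤ n → (∀ j → i < j → j ≤ n → f j ≡ 0ℚ) →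
                 sumTo i f ≡ sumTo n f
  sumTo-extend {i} {n} {f} i≤n vanish with ℕ.m≤n⇒m<n∨m≡n i≤n
  ... | inj₂ refl = refl
  sumTo-extend {i} {suc n} {f} _ vanish | inj₁ (s≤s i≤n) = begin
    sumTo i f              ≡⟨ sumTo-extend i≤n (λ j i<j j≤n → vanish j i<j (ℕ.m≤n⇒m≤1+n j≤n)) ⟩
    sumTo n f              ≡⟨ +-identityʳ (sumTo n f) ⟨
    sumTo n f + 0ℚ         ≡⟨ cong (sumTo n f +_) (vanish (suc n) (s≤s i≤n) ℕ.≤-refl) ⟨
    sumTo n f + f (suc n)  ∎
    where open ≡-Reasoning

  sumTo-swap : ∀ n m (F : ℕ → ℕ → ℚ) →
               sumTo n (λ i → sumTo m (F i)) ≡ sumTo m (λ j → sumTo n (λ i → F i j))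
  sumTo-swap zero    m F = refl
  sumTo-swap (suc n) m F = trans (cong (_+ sumTo m (F (suc n))) (sumTo-swap n m F))
    (sym (sumTo-+ m (λ j → sumTo n (λ i → F i j)) (F (suc n))))

  sumTo-telescope : ∀ n (a : ℕ → ℚ) → sumTo n a - sumTo n (λ k → a (suc k)) ≡ a 0 - a (suc n)
  sumTo-telescope zero    a = refl
  sumTo-telescope (suc n) a = begin
    (S + a (1 ℕ.+ n)) - (S′ + a (2 ℕ.+ n))     ≡⟨ solve 4 (λ x y z w → (x :+ z) :- (y :+ w) := (x :- y) :+ (z :- w)) refl S S′ (a (1 ℕ.+ n)) (a (2 ℕ.+ n)) ⟩
    (S - S′) + (a (1 ℕ.+ n) - a (2 ℕ.+ n))     ≡⟨ cong (_+ (a (1 ℕ.+ n) - a (2 ℕ.+ n))) (sumTo-telescope n a) ⟩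
    (a 0 - a (1 ℕ.+ n)) + (a (1 ℕ.+ n) - a (2 ℕ.+ n)) ≡⟨ solve 3 (λ x y z → (x :- y) :+ (y :- z) := x :- z) refl (a 0) (a (1 ℕ.+ n)) (a (2 ℕ.+ n)) ⟩
    a 0 - a (2 ℕ.+ n)                           ∎
    where
    open ≡-Reasoning
    open ℚ-Solver
    S  = sumTo n a
    S′ = sumTo n (λ k → a (suc k))

  sumTo-telescope₂ : ∀ n (b : ℕ → ℚ) →
    sumTo n b - sumTo n (λ k → b (2 ℕ.+ k)) ≡ (b 0 - b (suc n)) + (b 1 - b (2 ℕ.+ n))
  sumTo-telescope₂ n b = trans
    (solve 3 (λ x y z → x :- z := (x :- y) :+ (y :- z)) refl
      (sumTo n b) (sumTo n (λ k → b (suc k))) (sumTo n (λ k → b (2 ℕ.+ k))))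
    (cong₂ _+_ (sumTo-telescope n b) (sumTo-telescope n (λ k → b (suc k))))
    where open ℚ-Solver

  -- Formal power series

  infix 4 _≈_
  _≈_ : Series → Series → Set
  f ≈ g = ∀ n → f n ≡ g n

  ≈-refl : ∀ {f} → f ≈ f
  ≈-refl n = refl

  ≈-sym : ∀ {f g} → f ≈ g → g ≈ f
  ≈-sym eq n = sym (eq n)

  ≈-trans : ∀ {f g h} → f ≈ g → g ≈ h → f ≈ h
  ≈-trans eq eq′ n = trans (eq n) (eq′ n)

  smulS : ℚ → Series → Series
  smulS c f n = c * f n

  constS : ℚ → Series
  constS c = smulS c oneS

  mulS-cong : ∀ {f f′ g g′} → f ≈ f′ → g ≈ g′ → mulS f g ≈ mulS f′ g′
  mulS-cong eq eq′ n = sumTo-cong n (λ i → cong₂ _*_ (eq i) (eq′ (n ∸ i)))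

  mulS-congʳ-≤ : ∀ f {g g′} n → (∀ j → j ≤ n → g j ≡ g′ j) → mulS f g n ≡ mulS f g′ n
  mulS-congʳ-≤ f n eq = sumTo-cong n (λ i → cong (f i *_) (eq (n ∸ i) (ℕ.m∸n≤m n i)))

  mulS-unfold : ∀ f g n → mulS f g (suc n) ≡ f 0 * g (suc n) + mulS (shiftS f) g n
  mulS-unfold f g n = sumTo-unfoldˡ n (λ i → f i * g (suc n ∸ i))

  mulS-comm : ∀ f g → mulS f g ≈ mulS g f
  mulS-comm f g zero          = *-comm (f 0) (g 0)
  mulS-comm f g (suc zero)    = begin
    f 0 * g 1 + f 1 * g 0  ≡⟨ cong₂ _+_ (*-comm (f 0) (g 1)) (*-comm (f 1) (g 0)) ⟩
    g 1 * f 0 + g 0 * f 1  ≡⟨ +-comm (g 1 * f 0) (g 0 * f 1) ⟩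
    g 0 * f 1 + g 1 * f 0  ∎
    where open ≡-Reasoning
  mulS-comm f g (suc (suc m)) = begin
    mulS f g (2 ℕ.+ m)                                    ≡⟨ mulS-unfold f g (suc m) ⟩
    a + mulS (shiftS f) g (suc m)                         ≡⟨ cong (a +_) (trans (mulS-comm (shiftS f) g (suc m)) (mulS-unfold g (shiftS f) m)) ⟩
    a + (b + mulS (shiftS g) (shiftS f) m)                ≡⟨ cong (λ x → a + (b + x)) (mulS-comm (shiftS g) (shiftS f) m) ⟩
    a + (b + mulS (shiftS f) (shiftS g) m)                ≡⟨ solve 3 (λ x y z → x :+ (y :+ z) := y :+ (x :+ z)) refl a b _ ⟩
    b + (a + mulS (shiftS f) (shiftS g) m)                ≡⟨ cong (b +_) (trans (mulS-comm (shiftS g) f (suc m)) (mulS-unfold f (shiftS g) m)) ⟨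
    b + mulS (shiftS g) f (suc m)                         ≡⟨ mulS-unfold g f (suc m) ⟨
    mulS g f (2 ℕ.+ m)                                    ∎
    where
    open ≡-Reasoning
    open ℚ-Solver
    a = f 0 * g (2 ℕ.+ m)
    b = g 0 * f (2 ℕ.+ m)

  mulS-distribʳ : ∀ f g h → mulS (addS f g) h ≈ addS (mulS f h) (mulS g h)
  mulS-distribʳ f g h n =
    trans (sumTo-cong n (λ i → *-distribʳ-+ (h (n ∸ i)) (f i) (g i))) (sumTo-+ n _ _)

  mulS-distribˡ : ∀ f g h → mulS h (addS f g) ≈ addS (mulS h f) (mulS h g)
  mulS-distribˡ f g h n = trans (mulS-comm h (addS f g) n)
    (trans (mulS-distribʳ f g h n) (cong₂ _+_ (mulS-comm f h n) (mulS-comm g h n)))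

  mulS-distribʳ-subS : ∀ f g h → mulS (subS f g) h ≈ subS (mulS f h) (mulS g h)
  mulS-distribʳ-subS f g h n = trans
    (sumTo-cong n (λ i → trans (*-distribʳ-+ (h (n ∸ i)) (f i) (- g i))
      (cong (f i * h (n ∸ i) +_) (sym (neg-distribˡ-* (g i) (h (n ∸ i)))))))
    (trans (sumTo-+ n _ _) (cong (mulS f h n +_) (sym (sumTo-neg n _))))

  mulS-smulˡ : ∀ c f g → mulS (smulS c f) g ≈ smulS c (mulS f g)
  mulS-smulˡ c f g n =
    trans (sumTo-cong n (λ i → *-assoc c (f i) (g (n ∸ i)))) (sym (sumTo-*ˡ n c _))

  mulS-smulʳ : ∀ c f g → mulS f (smulS c g) ≈ smulS c (mulS f g)
  mulS-smulʳ c f g n = trans (mulS-comm f (smulS c g) n)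
    (trans (mulS-smulˡ c g f n) (cong (c *_) (mulS-comm g f n)))

  mulS-assoc : ∀ f g h → mulS (mulS f g) h ≈ mulS f (mulS g h)
  mulS-assoc f g h zero    = *-assoc (f 0) (g 0) (h 0)
  mulS-assoc f g h (suc n) = begin
    mulS (mulS f g) h (suc n)
      ≡⟨ mulS-unfold (mulS f g) h n ⟩
    f 0 * g 0 * h (suc n) + mulS (shiftS (mulS f g)) h n
      ≡⟨ cong (f 0 * g 0 * h (suc n) +_) (mulS-cong {g = h} (mulS-unfold f g) ≈-refl n) ⟩
    f 0 * g 0 * h (suc n) + mulS (addS (smulS (f 0) (shiftS g)) (mulS (shiftS f) g)) h n
      ≡⟨ cong (f 0 * g 0 * h (suc n) +_) (mulS-distribʳ (smulS (f 0) (shiftS g)) (mulS (shiftS f) g) h n) ⟩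
    f 0 * g 0 * h (suc n) + (mulS (smulS (f 0) (shiftS g)) h n + mulS (mulS (shiftS f) g) h n)
      ≡⟨ cong₂ (λ a b → f 0 * g 0 * h (suc n) + (a + b)) (mulS-smulˡ (f 0) (shiftS g) h n) (mulS-assoc (shiftS f) g h n) ⟩
    f 0 * g 0 * h (suc n) + (f 0 * mulS (shiftS g) h n + mulS (shiftS f) (mulS g h) n)
      ≡⟨ solve 5 (λ a b c d e → a :* b :* c :+ (a :* d :+ e) := a :* (b :* c :+ d) :+ e) refl
           (f 0) (g 0) (h (suc n)) (mulS (shiftS g) h n) _ ⟩
    f 0 * (g 0 * h (suc n) + mulS (shiftS g) h n) + mulS (shiftS f) (mulS g h) n
      ≡⟨ cong (λ x → f 0 * x + mulS (shiftS f) (mulS g h) n) (mulS-unfold g h n) ⟨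
    f 0 * mulS g h (suc n) + mulS (shiftS f) (mulS g h) n
      ≡⟨ mulS-unfold f (mulS g h) n ⟨
    mulS f (mulS g h) (suc n) ∎
    where
    open ≡-Reasoning
    open ℚ-Solver

  mulS-identityˡ : ∀ f → mulS oneS f ≈ f
  mulS-identityˡ f zero    = *-identityˡ (f 0)
  mulS-identityˡ f (suc n) = trans (mulS-unfold oneS f n)
    (trans (cong₂ _+_ (*-identityˡ (f (suc n))) (sumTo-zero n (λ i _ → *-zeroˡ (f (n ∸ i)))))
           (+-identityʳ _))

  mulS-identityʳ : ∀ f → mulS f oneS ≈ f
  mulS-identityʳ f n = trans (mulS-comm f oneS n) (mulS-identityˡ f n)

  mulS-constS : ∀ c f → mulS (constS c) f ≈ smulS c f
  mulS-constS c f n = trans (mulS-smulˡ c oneS f n) (cong (c *_) (mulS-identityˡ f n))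

  mulS-cancelˡ : ∀ Y {X Z} → Y 0 ≡ 1ℚ → mulS Y X ≈ mulS Y Z → X ≈ Z
  mulS-cancelˡ Y {X} {Z} Y0≡1 eq n = go n n ℕ.≤-refl
    where
    unit : ∀ (V : Series) m → Y 0 * V m ≡ V m
    unit V m = trans (cong (_* V m) Y0≡1) (*-identityˡ (V m))
    go : ∀ bound m → m ≤ bound → X m ≡ Z m
    go bound       zero    _         = trans (sym (unit X 0)) (trans (eq 0) (unit Z 0))
    go (suc bound) (suc m) (s≤s m≤b) = begin
      X (suc m)                                ≡⟨ unit X (suc m) ⟨
      Y 0 * X (suc m)                          ≡⟨ solve 2 (λ x r → x := (x :+ r) :- r) refl _ (rest X) ⟩
      (Y 0 * X (suc m) + rest X) - rest X      ≡⟨ cong₂ _-_ (trans (sym (mulS-unfold Y X m)) (trans (eq (suc m)) (mulS-unfold Y Z m)))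
                                                            (mulS-congʳ-≤ (shiftS Y) m (λ j j≤m → go bound j (ℕ.≤-trans j≤m m≤b))) ⟩
      (Y 0 * Z (suc m) + rest Z) - rest Z      ≡⟨ solve 2 (λ x r → (x :+ r) :- r := x) refl _ (rest Z) ⟩
      Y 0 * Z (suc m)                          ≡⟨ unit Z (suc m) ⟩
      Z (suc m)                                ∎
      where
      open ≡-Reasoning
      open ℚ-Solver
      rest : Series → ℚ
      rest V = mulS (shiftS Y) V m

  negS : Series → Series
  negS f n = - f n

  seriesCommutativeRing : CommutativeRing _ _
  seriesCommutativeRing = record { isCommutativeRing = isCommutativeRing }
    where
    isCommutativeRing : IsCommutativeRing _≈_ addS mulS negS (constS 0ℚ) oneS
    isCommutativeRing = record
      { isRing = record
        { +-isAbelianGroup = record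
          { isGroup = record
            { isMonoid = record
              { isSemigroup = record
                { isMagma = record
                  { isEquivalence = record { refl = λ {f} → ≈-refl {f} ; sym = λ {f} {g} → ≈-sym {f} {g} ; trans = λ {f} {g} {h} → ≈-trans {f} {g} {h} }
                  ; ∙-cong = λ eq eq′ n → cong₂ _+_ (eq n) (eq′ n) }
                ; assoc = λ f g h n → +-assoc (f n) (g n) (h n) }
              ; identity = (λ f n → trans (cong (_+ f n) (*-zeroˡ (oneS n))) (+-identityˡ (f n)))
                         , (λ f n → trans (cong (f n +_) (*-zeroˡ (oneS n))) (+-identityʳ (f n))) }
            ; inverse = (λ f n → trans (+-inverseˡ (f n)) (sym (*-zeroˡ (oneS n))))
                      , (λ f n → trans (+-inverseʳ (f n)) (sym (*-zeroˡ (oneS n))))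
            ; ⁻¹-cong = λ eq n → cong -_ (eq n) }
          ; comm = λ f g n → +-comm (f n) (g n) }
        ; *-cong = λ {f} {f′} {g} {g′} → mulS-cong {f} {f′} {g} {g′}
        ; *-assoc = mulS-assoc
        ; *-identity = mulS-identityˡ , mulS-identityʳ
        ; distrib = (λ h f g → mulS-distribˡ f g h) , (λ h f g → mulS-distribʳ f g h) }
      ; *-comm = mulS-comm }

  constS-homomorphism : CommutativeRing.rawRing +-*-commutativeRing
                          -Raw-AlmostCommutative⟶ fromCommutativeRing seriesCommutativeRing
  constS-homomorphism = record
    { ⟦_⟧    = constS
    ; +-homo = λ c d n → *-distribʳ-+ (oneS n) c d
    ; *-homo = λ c d n → trans (*-assoc c d (oneS n)) (sym (mulS-constS c (constS d) n))
    ; -‿homo = λ c n → sym (neg-distribˡ-* c (oneS n))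
    ; 0-homo = λ n → refl
    ; 1-homo = λ n → *-identityˡ (oneS n) }

  constS-≟ : ∀ c d → Maybe (constS c ≈ constS d)
  constS-≟ c d with c ≟ d
  ... | yes refl = just ≈-refl
  ... | no _     = nothing

  module SeriesSolver = Algebra.Solver.Ring (CommutativeRing.rawRing +-*-commutativeRing)
    (fromCommutativeRing seriesCommutativeRing) constS-homomorphism constS-≟
    renaming (_:=_ to _:≈_)

  ∂ : Series → Series
  ∂ f n = fromℕ (suc n) * f (suc n)

  ∂-cong : ∀ {f g} → f ≈ g → ∂ f ≈ ∂ g
  ∂-cong eq n = cong (fromℕ (suc n) *_) (eq (suc n))

  ∂-addS : ∀ f g → ∂ (addS f g) ≈ addS (∂ f) (∂ g)
  ∂-addS f g n = *-distribˡ-+ (fromℕ (suc n)) (f (suc n)) (g (suc n))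

  ∂-subS : ∀ f g → ∂ (subS f g) ≈ subS (∂ f) (∂ g)
  ∂-subS f g n = trans (*-distribˡ-+ (fromℕ (suc n)) (f (suc n)) (- g (suc n)))
    (cong (fromℕ (suc n) * f (suc n) +_) (sym (neg-distribʳ-* (fromℕ (suc n)) (g (suc n)))))

  ∂-smulS : ∀ c f → ∂ (smulS c f) ≈ smulS c (∂ f)
  ∂-smulS c f n = solve 3 (λ k a x → k :* (a :* x) := a :* (k :* x)) refl (fromℕ (suc n)) c (f (suc n))
    where open ℚ-Solver

  ∂-oneS : ∀ n → ∂ oneS n ≡ 0ℚ
  ∂-oneS n = *-zeroʳ (fromℕ (suc n))

  ∂-tS : ∂ tS ≈ oneS
  ∂-tS zero    = refl
  ∂-tS (suc n) = *-zeroʳ (fromℕ (2 ℕ.+ n))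

  ∂-mulS : ∀ f g → ∂ (mulS f g) ≈ addS (mulS (∂ f) g) (mulS f (∂ g))
  ∂-mulS f g n = begin
    fromℕ N * sumTo N (λ i → f i * g (N ∸ i))
      ≡⟨ sumTo-*ˡ N (fromℕ N) _ ⟩
    sumTo N (λ i → fromℕ N * (f i * g (N ∸ i)))
      ≡⟨ sumTo-cong≤ N split ⟩
    sumTo N (λ i → fromℕ i * f i * g (N ∸ i) + f i * (fromℕ (N ∸ i) * g (N ∸ i)))
      ≡⟨ sumTo-+ N _ _ ⟩
    sumTo N (λ i → fromℕ i * f i * g (N ∸ i)) + sumTo N (λ i → f i * (fromℕ (N ∸ i) * g (N ∸ i)))
      ≡⟨ cong₂ _+_ left right ⟩
    mulS (∂ f) g n + mulS f (∂ g) n ∎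
    where
    open ≡-Reasoning
    open ℚ-Solver
    N = suc n
    split : ∀ i → i ≤ N →
            fromℕ N * (f i * g (N ∸ i)) ≡ fromℕ i * f i * g (N ∸ i) + f i * (fromℕ (N ∸ i) * g (N ∸ i))
    split i i≤N = trans (cong (λ k → fromℕ k * (f i * g (N ∸ i))) (sym (ℕ.m+[n∸m]≡n i≤N)))
      (trans (cong (_* (f i * g (N ∸ i))) (fromℕ-+ i (N ∸ i)))
        (solve 4 (λ a b c d → (a :+ b) :* (c :* d) := a :* c :* d :+ c :* (b :* d)) refl
          (fromℕ i) (fromℕ (N ∸ i)) (f i) (g (N ∸ i))))
    left : sumTo N (λ i → fromℕ i * f i * g (N ∸ i)) ≡ mulS (∂ f) g n
    left = trans (sumTo-unfoldˡ n _) (trans (cong (_+ mulS (∂ f) g n)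
      (trans (cong (_* g N) (*-zeroˡ (f 0))) (*-zeroˡ (g N)))) (+-identityˡ _))
    right : sumTo N (λ i → f i * (fromℕ (N ∸ i) * g (N ∸ i))) ≡ mulS f (∂ g) n
    right = begin
      sumTo n (λ i → f i * (fromℕ (N ∸ i) * g (N ∸ i))) + f N * (fromℕ (N ∸ N) * g (N ∸ N))
        ≡⟨ cong₂ _+_ (sumTo-cong≤ n (λ i i≤n → cong (λ k → f i * (fromℕ k * g k)) (ℕ.+-∸-assoc 1 i≤n)))
                     (trans (cong (λ k → f N * (fromℕ k * g k)) (ℕ.n∸n≡0 N)) (trans (cong (f N *_) (*-zeroˡ (g 0))) (*-zeroʳ (f N)))) ⟩
      mulS f (∂ g) n + 0ℚ
        ≡⟨ +-identityʳ _ ⟩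
      mulS f (∂ g) n ∎

  ∂-injective : ∀ {f g} → f 0 ≡ g 0 → ∂ f ≈ ∂ g → f ≈ g
  ∂-injective eq₀ eq zero    = eq₀
  ∂-injective eq₀ eq (suc n) = fromℕ-suc-cancel n (eq n)

  linear-ode-unique : ∀ c {f g} → f 0 ≡ g 0 → ∂ f ≈ smulS c f → ∂ g ≈ smulS c g → f ≈ g
  linear-ode-unique c eq₀ ode-f ode-g zero    = eq₀
  linear-ode-unique c eq₀ ode-f ode-g (suc n) = fromℕ-suc-cancel n
    (trans (ode-f n) (trans (cong (c *_) (linear-ode-unique c eq₀ ode-f ode-g n)) (sym (ode-g n))))

  powS-cong : ∀ {g g′} → g ≈ g′ → ∀ k → powS g k ≈ powS g′ k
  powS-cong eq zero    = ≈-refl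
  powS-cong eq (suc k) = mulS-cong eq (powS-cong eq k)

  powS-suc : ∀ g k → mulS (powS g k) g ≈ powS g (suc k)
  powS-suc g k = mulS-comm (powS g k) g

  powS-vanishes : ∀ g → g 0 ≡ 0ℚ → ∀ {k n} → n < k → powS g k n ≡ 0ℚ
  powS-vanishes g g₀ {suc k} {zero}  _         = trans (cong (_* powS g k 0) g₀) (*-zeroˡ (powS g k 0))
  powS-vanishes g g₀ {suc k} {suc n} (s≤s n<k) = trans (mulS-unfold g (powS g k) n)
    (trans (cong₂ _+_ (trans (cong (_* powS g k (suc n)) g₀) (*-zeroˡ (powS g k (suc n))))
                      (sumTo-zero n (λ i _ → trans (cong (g (suc i) *_)
                        (powS-vanishes g g₀ (ℕ.≤-<-trans (ℕ.m∸n≤m n i) n<k))) (*-zeroʳ (g (suc i))))))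
           (+-identityʳ 0ℚ))

  ∂-powS : ∀ g k → ∂ (powS g (suc k)) ≈ smulS (fromℕ (suc k)) (mulS (powS g k) (∂ g))
  ∂-powS g zero n = begin
    ∂ (mulS g oneS) n                        ≡⟨ ∂-cong (mulS-identityʳ g) n ⟩
    ∂ g n                                    ≡⟨ mulS-identityˡ (∂ g) n ⟨
    mulS oneS (∂ g) n                        ≡⟨ *-identityˡ _ ⟨
    1ℚ * mulS oneS (∂ g) n                   ∎
    where open ≡-Reasoning
  ∂-powS g (suc k) n = begin
    ∂ (mulS g P) n                                              ≡⟨ ∂-mulS g P n ⟩
    mulS (∂ g) P n + mulS g (∂ P) n                             ≡⟨ cong (mulS (∂ g) P n +_) (mulS-cong {g} ≈-refl (∂-powS g k) n) ⟩
    mulS (∂ g) P n + mulS g (smulS c (mulS Q (∂ g))) n          ≡⟨ cong (mulS (∂ g) P n +_) (mulS-smulʳ c g (mulS Q (∂ g)) n) ⟩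
    mulS (∂ g) P n + c * mulS g (mulS Q (∂ g)) n                ≡⟨ cong₂ (λ a b → a + c * b) (mulS-comm (∂ g) P n) (sym (mulS-assoc g Q (∂ g) n)) ⟩
    mulS P (∂ g) n + c * mulS P (∂ g) n                         ≡⟨ solve 2 (λ a b → a :+ b :* a := (con 1ℚ :+ b) :* a) refl (mulS P (∂ g) n) c ⟩
    (1ℚ + c) * mulS P (∂ g) n                                   ≡⟨ cong (_* mulS P (∂ g) n) (fromℕ-suc (suc k)) ⟨
    fromℕ (2 ℕ.+ k) * mulS P (∂ g) n                            ∎
    where
    open ≡-Reasoning
    open ℚ-Solver
    c = fromℕ (suc k)
    Q = powS g k
    P = powS g (suc k)

  compS-cong : ∀ {f f′ g g′} → f ≈ f′ → g ≈ g′ → compS f g ≈ compS f′ g′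
  compS-cong eq eq′ n = sumTo-cong n (λ k → cong₂ _*_ (eq k) (powS-cong eq′ k n))

  -- Each coefficient compS c g i is a sum up to i, which may be extended to n since
  -- powS g k i vanishes for k > i.
  mulS-compS : ∀ c g h → g 0 ≡ 0ℚ → ∀ n →
               mulS (compS c g) h n ≡ sumTo n (λ k → c k * mulS (powS g k) h n)
  mulS-compS c g h g₀ n = begin
    sumTo n (λ i → sumTo i (λ k → c k * powS g k i) * h (n ∸ i))
      ≡⟨ sumTo-cong≤ n (λ i i≤n → cong (_* h (n ∸ i)) (sumTo-extend i≤n
           (λ k i<k _ → trans (cong (c k *_) (powS-vanishes g g₀ i<k)) (*-zeroʳ (c k))))) ⟩
    sumTo n (λ i → sumTo n (λ k → c k * powS g k i) * h (n ∸ i))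
      ≡⟨ sumTo-cong n (λ i → sumTo-*ʳ n (h (n ∸ i)) _) ⟩
    sumTo n (λ i → sumTo n (λ k → c k * powS g k i * h (n ∸ i)))
      ≡⟨ sumTo-swap n n _ ⟩
    sumTo n (λ k → sumTo n (λ i → c k * powS g k i * h (n ∸ i)))
      ≡⟨ sumTo-cong n (λ k → trans (sumTo-cong n (λ i → *-assoc (c k) _ _)) (sym (sumTo-*ˡ n (c k) _))) ⟩
    sumTo n (λ k → c k * mulS (powS g k) h n) ∎
    where open ≡-Reasoning

  ∂-compS : ∀ c g → g 0 ≡ 0ℚ → ∂ (compS c g) ≈ mulS (compS (∂ c) g) (∂ g)
  ∂-compS c g g₀ n = begin
    fromℕ N * sumTo N (λ k → c k * powS g k N)
      ≡⟨ sumTo-*ˡ N (fromℕ N) _ ⟩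
    sumTo N (λ k → fromℕ N * (c k * powS g k N))
      ≡⟨ sumTo-cong N (λ k → solve 3 (λ a b x → a :* (b :* x) := b :* (a :* x)) refl (fromℕ N) (c k) (powS g k N)) ⟩
    sumTo N (λ k → c k * ∂ (powS g k) n)
      ≡⟨ sumTo-unfoldˡ n _ ⟩
    c 0 * ∂ oneS n + sumTo n (λ k → c (suc k) * ∂ (powS g (suc k)) n)
      ≡⟨ cong₂ _+_ (trans (cong (c 0 *_) (∂-oneS n)) (*-zeroʳ (c 0))) (sumTo-cong n (λ k → cong (c (suc k) *_) (∂-powS g k n))) ⟩
    0ℚ + sumTo n (λ k → c (suc k) * (fromℕ (suc k) * mulS (powS g k) (∂ g) n))
      ≡⟨ +-identityˡ _ ⟩
    sumTo n (λ k → c (suc k) * (fromℕ (suc k) * mulS (powS g k) (∂ g) n))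
      ≡⟨ sumTo-cong n (λ k → solve 3 (λ a b x → a :* (b :* x) := b :* a :* x) refl (c (suc k)) (fromℕ (suc k)) (mulS (powS g k) (∂ g) n)) ⟩
    sumTo n (λ k → ∂ c k * mulS (powS g k) (∂ g) n)
      ≡⟨ mulS-compS (∂ c) g (∂ g) g₀ n ⟨
    mulS (compS (∂ c) g) (∂ g) n ∎
    where
    open ≡-Reasoning
    open ℚ-Solver
    N = suc n

  ^ℚ-+ : ∀ c a b → c ^ℚ (a ℕ.+ b) ≡ c ^ℚ a * c ^ℚ b
  ^ℚ-+ c zero    b = sym (*-identityˡ _)
  ^ℚ-+ c (suc a) b = trans (cong (c *_) (^ℚ-+ c a b)) (sym (*-assoc c _ _))

  scaleS-cong : ∀ c {f g} → f ≈ g → scaleS c f ≈ scaleS c g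
  scaleS-cong c eq n = cong (_* c ^ℚ n) (eq n)

  scaleS-oneS : ∀ c → scaleS c oneS ≈ oneS
  scaleS-oneS c zero    = refl
  scaleS-oneS c (suc n) = *-zeroˡ (c ^ℚ suc n)

  scaleS-subS : ∀ c f g → scaleS c (subS f g) ≈ subS (scaleS c f) (scaleS c g)
  scaleS-subS c f g n = trans (*-distribʳ-+ (c ^ℚ n) (f n) (- g n))
    (cong (f n * c ^ℚ n +_) (sym (neg-distribˡ-* (g n) (c ^ℚ n))))

  scaleS-mulS : ∀ c f g → scaleS c (mulS f g) ≈ mulS (scaleS c f) (scaleS c g)
  scaleS-mulS c f g n = trans (sumTo-*ʳ n (c ^ℚ n) _) (sumTo-cong≤ n (λ i i≤n → trans
    (cong (λ k → f i * g (n ∸ i) * c ^ℚ k) (sym (ℕ.m+[n∸m]≡n i≤n)))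
    (trans (cong (f i * g (n ∸ i) *_) (^ℚ-+ c i (n ∸ i)))
      (solve 4 (λ a b x y → a :* b :* (x :* y) := a :* x :* (b :* y)) refl (f i) (g (n ∸ i)) (c ^ℚ i) (c ^ℚ (n ∸ i))))))
    where open ℚ-Solver

  ∂-scaleS : ∀ c f → ∂ (scaleS c f) ≈ smulS c (scaleS c (∂ f))
  ∂-scaleS c f n = solve 4 (λ a b x y → a :* (b :* (x :* y)) := x :* (a :* b :* y)) refl
    (fromℕ (suc n)) (f (suc n)) c (c ^ℚ n)
    where open ℚ-Solver

  shiftS-scaleS : ∀ c f → shiftS (scaleS c f) ≈ smulS c (scaleS c (shiftS f))
  shiftS-scaleS c f n = solve 3 (λ a x y → a :* (x :* y) := x :* (a :* y)) refl (f (suc n)) c (c ^ℚ n)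
    where open ℚ-Solver

  -- Inverses, the exponential and the hyperbolic functions

  mulS-geometric : ∀ h → h 0 ≡ 0ℚ → mulS (compS (λ _ → 1ℚ) h) (subS oneS h) ≈ oneS
  mulS-geometric h h₀ n = begin
    mulS C (subS oneS h) n                                        ≡⟨ mulS-comm C (subS oneS h) n ⟩
    mulS (subS oneS h) C n                                        ≡⟨ mulS-distribʳ-subS oneS h C n ⟩
    mulS oneS C n - mulS h C n                                    ≡⟨ cong₂ _-_ (mulS-identityˡ C n) (mulS-comm h C n) ⟩
    C n - mulS C h n                                              ≡⟨ cong (λ x → C n - x) (mulS-compS (λ _ → 1ℚ) h h h₀ n) ⟩
    C n - sumTo n (λ k → 1ℚ * mulS (powS h k) h n)                ≡⟨ cong₂ _-_ (sumTo-cong n (λ k → *-identityˡ _))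
                                                                               (sumTo-cong n (λ k → trans (*-identityˡ _) (powS-suc h k n))) ⟩
    sumTo n (λ k → powS h k n) - sumTo n (λ k → powS h (suc k) n) ≡⟨ sumTo-telescope n (λ k → powS h k n) ⟩
    oneS n - powS h (suc n) n                                     ≡⟨ cong (λ x → oneS n - x) (powS-vanishes h h₀ {suc n} ℕ.≤-refl) ⟩
    oneS n - 0ℚ                                                   ≡⟨ +-identityʳ (oneS n) ⟩
    oneS n                                                        ∎
    where
    open ≡-Reasoning
    C = compS (λ _ → 1ℚ) h

  inv1S-inverse : ∀ f → f 0 ≡ 1ℚ → mulS (inv1S f) f ≈ oneS
  inv1S-inverse f f₀ = ≈-trans (mulS-cong {inv1S f} ≈-refl f≈1-[1-f])
    (mulS-geometric (subS oneS f) (cong (λ x → 1ℚ - x) f₀))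
    where
    f≈1-[1-f] : f ≈ subS oneS (subS oneS f)
    f≈1-[1-f] n = sym (solve 2 (λ a b → a :- (a :- b) := b) refl (oneS n) (f n))
      where open ℚ-Solver

  divS-mulS : ∀ F G → G 1 ≡ 1ℚ → mulS (divS F G) (shiftS G) ≈ shiftS F
  divS-mulS F G G₁ = ≈-trans (mulS-assoc (shiftS F) (inv1S (shiftS G)) (shiftS G))
    (≈-trans (mulS-cong {shiftS F} ≈-refl (inv1S-inverse (shiftS G) G₁)) (mulS-identityʳ (shiftS F)))

  ∂-expS : ∂ expS ≈ expS
  ∂-expS n = begin
    fromℕ (suc n) * invFact (suc n)                ≡⟨ cong (fromℕ (suc n) *_) (invFact-suc n) ⟩
    fromℕ (suc n) * (1/[1+ n ] * invFact n)        ≡⟨ *-assoc (fromℕ (suc n)) 1/[1+ n ] (invFact n) ⟨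
    fromℕ (suc n) * 1/[1+ n ] * invFact n          ≡⟨ cong (_* invFact n) (fromℕ-suc*1/[1+n] n) ⟩
    1ℚ * invFact n                                 ≡⟨ *-identityˡ (invFact n) ⟩
    invFact n                                      ∎
    where open ≡-Reasoning

  expNegS : Series
  expNegS = scaleS (- 1ℚ) expS

  ∂-expNegS : ∂ expNegS ≈ smulS (- 1ℚ) expNegS
  ∂-expNegS n = trans (∂-scaleS (- 1ℚ) expS n) (cong (- 1ℚ *_) (scaleS-cong (- 1ℚ) ∂-expS n))

  expS*expS : mulS expS expS ≈ scaleS (fromℕ 2) expS
  expS*expS = linear-ode-unique (fromℕ 2) {mulS expS expS} {scaleS (fromℕ 2) expS} refl ode-product ode-scaled
    where
    open ℚ-Solver
    ode-product : ∂ (mulS expS expS) ≈ smulS (fromℕ 2) (mulS expS expS)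
    ode-product n = trans (∂-mulS expS expS n)
      (trans (cong₂ _+_ (mulS-cong {∂ expS} {expS} {expS} ∂-expS ≈-refl n) (mulS-cong {expS} ≈-refl ∂-expS n))
        (solve 1 (λ a → a :+ a := con (fromℕ 2) :* a) refl (mulS expS expS n)))
    ode-scaled : ∂ (scaleS (fromℕ 2) expS) ≈ smulS (fromℕ 2) (scaleS (fromℕ 2) expS)
    ode-scaled n = trans (∂-scaleS (fromℕ 2) expS n) (cong (fromℕ 2 *_) (scaleS-cong (fromℕ 2) ∂-expS n))

  expNegS*expS : mulS expNegS expS ≈ oneS
  expNegS*expS = linear-ode-unique 0ℚ {mulS expNegS expS} {oneS} refl ode-product
    (λ n → trans (∂-oneS n) (sym (*-zeroˡ (oneS n))))
    where
    open ℚ-Solver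
    ode-product : ∂ (mulS expNegS expS) ≈ smulS 0ℚ (mulS expNegS expS)
    ode-product n = trans (∂-mulS expNegS expS n)
      (trans (cong₂ _+_ (trans (mulS-cong {∂ expNegS} {smulS (- 1ℚ) expNegS} {expS} ∂-expNegS ≈-refl n)
                               (mulS-smulˡ (- 1ℚ) expNegS expS n))
                        (mulS-cong {expNegS} ≈-refl ∂-expS n))
        (solve 1 (λ a → con (- 1ℚ) :* a :+ a := con 0ℚ :* a) refl (mulS expNegS expS n)))

  sinhS≈ : sinhS ≈ smulS ½ (subS expS expNegS)
  sinhS≈ n = cong (½ *_) (solve 2 (λ s e → (con 1ℚ :- s) :* e := e :- e :* s) refl (sgn n) (invFact n))
    where open ℚ-Solver

  coshS≈ : coshS ≈ smulS ½ (addS expS expNegS)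
  coshS≈ n = cong (½ *_) (solve 2 (λ s e → (con 1ℚ :+ s) :* e := e :+ e :* s) refl (sgn n) (invFact n))
    where open ℚ-Solver

  ∂-sinhS : ∂ sinhS ≈ coshS
  ∂-sinhS n = begin
    ∂ sinhS n                                ≡⟨ ∂-cong sinhS≈ n ⟩
    ∂ (smulS ½ (subS expS expNegS)) n        ≡⟨ ∂-smulS ½ (subS expS expNegS) n ⟩
    ½ * ∂ (subS expS expNegS) n              ≡⟨ cong (½ *_) (trans (∂-subS expS expNegS n) (cong₂ _-_ (∂-expS n) (∂-expNegS n))) ⟩
    ½ * (expS n - - 1ℚ * expNegS n)          ≡⟨ cong (½ *_) (solve 2 (λ a b → a :- con (- 1ℚ) :* b := a :+ b) refl (expS n) (expNegS n)) ⟩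
    ½ * (expS n + expNegS n)                 ≡⟨ coshS≈ n ⟨
    coshS n                                  ∎
    where
    open ≡-Reasoning
    open ℚ-Solver

  ∂-coshS : ∂ coshS ≈ sinhS
  ∂-coshS n = begin
    ∂ coshS n                                ≡⟨ ∂-cong coshS≈ n ⟩
    ∂ (smulS ½ (addS expS expNegS)) n        ≡⟨ ∂-smulS ½ (addS expS expNegS) n ⟩
    ½ * ∂ (addS expS expNegS) n              ≡⟨ cong (½ *_) (trans (∂-addS expS expNegS n) (cong₂ _+_ (∂-expS n) (∂-expNegS n))) ⟩
    ½ * (expS n + - 1ℚ * expNegS n)          ≡⟨ cong (½ *_) (solve 2 (λ a b → a :+ con (- 1ℚ) :* b := a :- b) refl (expS n) (expNegS n)) ⟩
    ½ * (expS n - expNegS n)                 ≡⟨ sinhS≈ n ⟨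
    sinhS n                                  ∎
    where
    open ≡-Reasoning
    open ℚ-Solver

  tanhS*coshS : mulS tanhS coshS ≈ sinhS
  tanhS*coshS = ≈-trans (mulS-assoc sinhS (inv1S coshS) coshS)
    (≈-trans (mulS-cong {sinhS} ≈-refl (inv1S-inverse coshS refl)) (mulS-identityʳ sinhS))

  ∂-tanhS : ∂ tanhS ≈ subS oneS (mulS tanhS tanhS)
  ∂-tanhS = mulS-cancelˡ coshS refl (λ n → begin
    mulS coshS (∂ tanhS) n                            ≡⟨ mulS-comm coshS (∂ tanhS) n ⟩
    mulS (∂ tanhS) coshS n                            ≡⟨ quotient-rule n ⟩
    coshS n - mulS tanhS sinhS n                      ≡⟨ cong (λ x → coshS n - x) (mulS-cong {tanhS} ≈-refl (≈-sym tanhS*coshS) n) ⟩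
    coshS n - mulS tanhS (mulS tanhS coshS) n         ≡⟨ cong₂ _-_ (mulS-identityʳ coshS n) (mulS-assoc tanhS tanhS coshS n) ⟨
    mulS coshS oneS n - mulS (mulS tanhS tanhS) coshS n ≡⟨ cong (λ x → mulS coshS oneS n - x) (mulS-comm (mulS tanhS tanhS) coshS n) ⟩
    mulS coshS oneS n - mulS coshS (mulS tanhS tanhS) n ≡⟨ sym (trans (mulS-comm coshS (subS oneS (mulS tanhS tanhS)) n)
                                                             (trans (mulS-distribʳ-subS oneS (mulS tanhS tanhS) coshS n)
                                                               (cong₂ _-_ (mulS-comm oneS coshS n) (mulS-comm (mulS tanhS tanhS) coshS n)))) ⟩
    mulS coshS (subS oneS (mulS tanhS tanhS)) n       ∎)
    where
    open ≡-Reasoning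
    quotient-rule : ∀ n → mulS (∂ tanhS) coshS n ≡ coshS n - mulS tanhS sinhS n
    quotient-rule n = begin
      mulS (∂ tanhS) coshS n                                           ≡⟨ solve 2 (λ a b → a := (a :+ b) :- b) refl _ (mulS tanhS sinhS n) ⟩
      (mulS (∂ tanhS) coshS n + mulS tanhS sinhS n) - mulS tanhS sinhS n ≡⟨ cong (λ x → (mulS (∂ tanhS) coshS n + x) - mulS tanhS sinhS n)
                                                                             (mulS-cong {tanhS} ≈-refl ∂-coshS n) ⟨
      (mulS (∂ tanhS) coshS n + mulS tanhS (∂ coshS) n) - mulS tanhS sinhS n ≡⟨ cong (_- mulS tanhS sinhS n) (∂-mulS tanhS coshS n) ⟨
      ∂ (mulS tanhS coshS) n - mulS tanhS sinhS n                    ≡⟨ cong (_- mulS tanhS sinhS n) (trans (∂-cong tanhS*coshS n) (∂-sinhS n)) ⟩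
      coshS n - mulS tanhS sinhS n                                     ∎
      where open ℚ-Solver

  halfTanhS : Series
  halfTanhS = scaleS ½ tanhS

  ∂-halfTanhS : ∂ halfTanhS ≈ smulS ½ (subS oneS (mulS halfTanhS halfTanhS))
  ∂-halfTanhS n = trans (∂-scaleS ½ tanhS n) (cong (½ *_)
    (trans (scaleS-cong ½ ∂-tanhS n) (trans (scaleS-subS ½ oneS (mulS tanhS tanhS) n)
      (cong₂ _-_ (scaleS-oneS ½ n) (scaleS-mulS ½ tanhS tanhS n)))))

  -- 2 / (1 - z²) = 2 + 2 z² + 2 z⁴ + ⋯
  twoEvenS : Series
  twoEvenS n = 1ℚ + sgn n

  ∂-A₁ : ∂ (AS (ℤ.+ 1)) ≈ twoEvenS
  ∂-A₁ n = trans
    (solve 3 (λ k r s → k :* (r :* con 1ℚ :- (con (- 1ℚ) :* s) :* (r :* con 1ℚ)) := k :* r :* (con 1ℚ :+ s)) refl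
      (fromℕ (suc n)) 1/[1+ n ] (sgn n))
    (trans (cong (_* twoEvenS n) (fromℕ-suc*1/[1+n] n)) (*-identityˡ _))
    where open ℚ-Solver

  twoEvenS∘g*[1-g²] : ∀ g → g 0 ≡ 0ℚ → mulS (compS twoEvenS g) (subS oneS (mulS g g)) ≈ constS (fromℕ 2)
  twoEvenS∘g*[1-g²] g g₀ n = begin
    mulS C (subS oneS g²) n                                ≡⟨ mulS-comm C (subS oneS g²) n ⟩
    mulS (subS oneS g²) C n                                ≡⟨ mulS-distribʳ-subS oneS g² C n ⟩
    mulS oneS C n - mulS g² C n                            ≡⟨ cong₂ _-_ (mulS-identityˡ C n) (mulS-comm g² C n) ⟩
    C n - mulS C g² n                                      ≡⟨ cong (λ x → C n - x) (mulS-compS twoEvenS g g² g₀ n) ⟩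
    C n - sumTo n (λ k → twoEvenS k * mulS (powS g k) g² n) ≡⟨ cong (λ x → C n - x) (sumTo-cong n (λ k → cong₂ _*_ (sym (periodic k)) (times-g² k n))) ⟩
    sumTo n b - sumTo n (λ k → b (2 ℕ.+ k))                ≡⟨ sumTo-telescope₂ n b ⟩
    (b 0 - b (suc n)) + (b 1 - b (2 ℕ.+ n))                ≡⟨ cong₂ (λ x y → (b 0 - x) + (b 1 - y)) (b-vanishes ℕ.≤-refl) (b-vanishes (ℕ.n≤1+n (suc n))) ⟩
    (b 0 - 0ℚ) + (twoEvenS 1 * powS g 1 n - 0ℚ)           ≡⟨ solve 2 (λ o x → (con (1ℚ + 1ℚ) :* o :- con 0ℚ) :+ (con 0ℚ :* x :- con 0ℚ) := con (fromℕ 2) :* o) refl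
                                                                (oneS n) (powS g 1 n) ⟩
    constS (fromℕ 2) n                                      ∎
    where
    open ≡-Reasoning
    open ℚ-Solver
    g² = mulS g g
    C  = compS twoEvenS g
    b : ℕ → ℚ
    b k = twoEvenS k * powS g k n
    periodic : ∀ k → twoEvenS (2 ℕ.+ k) ≡ twoEvenS k
    periodic k = cong (1ℚ +_) (solve 1 (λ s → con (- 1ℚ) :* (con (- 1ℚ) :* s) := s) refl (sgn k))
    times-g² : ∀ k → mulS (powS g k) g² ≈ powS g (2 ℕ.+ k)
    times-g² k m = trans (mulS-comm (powS g k) g² m) (mulS-assoc g g (powS g k) m)
    b-vanishes : ∀ {k} → n < k → b k ≡ 0ℚ
    b-vanishes {k} n<k = trans (cong (twoEvenS k *_) (powS-vanishes g g₀ n<k)) (*-zeroʳ (twoEvenS k))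

  -- Both sides vanish at 0 and have derivative 1: by the chain rule the left one has
  -- derivative (2 / (1 - u²)) · ½ (1 - u²) for u = tanh(t/2).
  A₁∘halfTanhS≈tS : compS (AS (ℤ.+ 1)) halfTanhS ≈ tS
  A₁∘halfTanhS≈tS = ∂-injective {compS (AS (ℤ.+ 1)) halfTanhS} {tS} refl (λ n → begin
    ∂ (compS A₁ u) n                                 ≡⟨ ∂-compS A₁ u u₀ n ⟩
    mulS (compS (∂ A₁) u) (∂ u) n                    ≡⟨ mulS-cong {compS (∂ A₁) u} {compS twoEvenS u} (compS-cong {∂ A₁} {twoEvenS} {u} ∂-A₁ ≈-refl) ∂-halfTanhS n ⟩
    mulS (compS twoEvenS u) (smulS ½ (subS oneS (mulS u u))) n ≡⟨ mulS-smulʳ ½ (compS twoEvenS u) (subS oneS (mulS u u)) n ⟩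
    ½ * mulS (compS twoEvenS u) (subS oneS (mulS u u)) n       ≡⟨ cong (½ *_) (twoEvenS∘g*[1-g²] u u₀ n) ⟩
    ½ * (fromℕ 2 * oneS n)                           ≡⟨ solve 1 (λ o → con ½ :* (con (fromℕ 2) :* o) := o) refl (oneS n) ⟩
    oneS n                                           ≡⟨ ∂-tS n ⟨
    ∂ tS n                                           ∎)
    where
    open ≡-Reasoning
    open ℚ-Solver
    A₁ = AS (ℤ.+ 1)
    u  = halfTanhS
    u₀ : u 0 ≡ 0ℚ
    u₀ = refl

  -- t / tanh t, t / sinh t and 2t / (e^t + 1) in terms of t / (e^t - 1)

  expm1S : Series
  expm1S = subS expS oneS

  expm1/tS : Series
  expm1/tS = shiftS expm1S

  bernoulliS : Series
  bernoulliS = divS tS expm1S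

  genocchiS : Series
  genocchiS = subS (mulS (constS (fromℕ 2)) bernoulliS) (mulS (constS (fromℕ 2)) (scaleS (fromℕ 2) bernoulliS))

  shiftS-tS : shiftS tS ≈ oneS
  shiftS-tS zero    = refl
  shiftS-tS (suc n) = refl

  shiftS-mulS : ∀ f g → f 0 ≡ 0ℚ → shiftS (mulS f g) ≈ mulS (shiftS f) g
  shiftS-mulS f g f₀ n = trans (mulS-unfold f g n)
    (trans (cong (λ x → x * g (suc n) + mulS (shiftS f) g n) f₀)
      (trans (cong (_+ mulS (shiftS f) g n) (*-zeroˡ (g (suc n)))) (+-identityˡ _)))

  tS*shiftS : ∀ f → f 0 ≡ 0ℚ → mulS tS (shiftS f) ≈ f
  tS*shiftS f f₀ zero    = trans (*-zeroˡ (f 1)) (sym f₀)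
  tS*shiftS f f₀ (suc n) = trans (mulS-unfold tS (shiftS f) n)
    (trans (cong₂ _+_ (*-zeroˡ (f (2 ℕ.+ n))) (mulS-cong {shiftS tS} {oneS} {shiftS f} shiftS-tS ≈-refl n))
      (trans (+-identityˡ _) (mulS-identityˡ (shiftS f) n)))

  bernoulliS*expm1/tS : mulS bernoulliS expm1/tS ≈ oneS
  bernoulliS*expm1/tS = ≈-trans (divS-mulS tS expm1S refl) shiftS-tS

  bernoulliS[2t]*expm1/tS[2t] : mulS (scaleS (fromℕ 2) bernoulliS) (scaleS (fromℕ 2) expm1/tS) ≈ oneS
  bernoulliS[2t]*expm1/tS[2t] = ≈-trans (≈-sym (scaleS-mulS (fromℕ 2) bernoulliS expm1/tS))
    (≈-trans (scaleS-cong (fromℕ 2) bernoulliS*expm1/tS) (scaleS-oneS (fromℕ 2)))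

  tanh/tS*coshS : mulS (shiftS tanhS) coshS ≈ shiftS sinhS
  tanh/tS*coshS = ≈-trans (≈-sym (shiftS-mulS tanhS coshS refl)) (λ n → tanhS*coshS (suc n))

  expm1S[2t] : scaleS (fromℕ 2) expm1S ≈ subS (mulS expS expS) oneS
  expm1S[2t] = ≈-trans (scaleS-subS (fromℕ 2) expS oneS)
    (λ n → cong₂ _-_ (sym (expS*expS n)) (scaleS-oneS (fromℕ 2) n))

  expm1/tS[2t] : shiftS (scaleS (fromℕ 2) expm1S) ≈ mulS (constS (fromℕ 2)) (scaleS (fromℕ 2) expm1/tS)
  expm1/tS[2t] = ≈-trans (shiftS-scaleS (fromℕ 2) expm1S)
    (≈-sym (mulS-constS (fromℕ 2) (scaleS (fromℕ 2) expm1/tS)))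

  expm1S*[expS+1] : mulS expm1S (addS expS oneS) ≈ subS (mulS expS expS) oneS
  expm1S*[expS+1] = ≈-trans
    (solve 2 (λ e o → (e :- o) :* (e :+ o) :≈ e :* e :- o :* o) ≈-refl expS oneS)
    (λ n → cong (λ x → mulS expS expS n - x) (mulS-identityˡ oneS n))
    where open SeriesSolver

  sinh/tS*expS : mulS (shiftS sinhS) expS ≈ scaleS (fromℕ 2) expm1/tS
  sinh/tS*expS = begin
    mulS (shiftS sinhS) expS                                          ≈⟨ ≈-sym (shiftS-mulS sinhS expS refl) ⟩
    shiftS (mulS sinhS expS)                                          ≈⟨ (λ n → sinhS*expS (suc n)) ⟩
    shiftS (mulS (constS ½) (scaleS (fromℕ 2) expm1S))                ≈⟨ (λ n → trans (mulS-constS ½ (scaleS (fromℕ 2) expm1S) (suc n))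
                                                                                   (sym (mulS-constS ½ (shiftS (scaleS (fromℕ 2) expm1S)) n))) ⟩
    mulS (constS ½) (shiftS (scaleS (fromℕ 2) expm1S))                ≈⟨ mulS-cong {constS ½} ≈-refl expm1/tS[2t] ⟩
    mulS (constS ½) (mulS (constS (fromℕ 2)) (scaleS (fromℕ 2) expm1/tS)) ≈⟨ solve 1 (λ a → con ½ :* (con (fromℕ 2) :* a) :≈ a) ≈-refl _ ⟩
    scaleS (fromℕ 2) expm1/tS                                         ∎
    where
    open SeriesSolver
    open import Relation.Binary.Reasoning.Setoid (CommutativeRing.setoid seriesCommutativeRing)
    sinhS*expS : mulS sinhS expS ≈ mulS (constS ½) (scaleS (fromℕ 2) expm1S)
    sinhS*expS = begin
      mulS sinhS expS                                                ≈⟨ mulS-cong {sinhS} {mulS (constS ½) (subS expS expNegS)} {expS}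
                                                                          (≈-trans sinhS≈ (≈-sym (mulS-constS ½ (subS expS expNegS)))) ≈-refl ⟩
      mulS (mulS (constS ½) (subS expS expNegS)) expS                ≈⟨ solve 3 (λ h e f → (h :* (e :- f)) :* e :≈ h :* (e :* e :- f :* e)) ≈-refl (constS ½) expS expNegS ⟩
      mulS (constS ½) (subS (mulS expS expS) (mulS expNegS expS))    ≈⟨ mulS-cong {constS ½} ≈-refl
                                                                          (≈-trans (λ n → cong (λ x → mulS expS expS n - x) (expNegS*expS n)) (≈-sym expm1S[2t])) ⟩
      mulS (constS ½) (scaleS (fromℕ 2) expm1S)                      ∎

  coshS*expS : mulS coshS expS ≈ mulS (constS ½) (addS (mulS expS expS) oneS)
  coshS*expS = begin
    mulS coshS expS                                                   ≈⟨ mulS-cong {coshS} {mulS (constS ½) (addS expS expNegS)} {expS}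
                                                                            (≈-trans coshS≈ (≈-sym (mulS-constS ½ (addS expS expNegS)))) ≈-refl ⟩
    mulS (mulS (constS ½) (addS expS expNegS)) expS                   ≈⟨ solve 3 (λ h e f → (h :* (e :+ f)) :* e :≈ h :* (e :* e :+ f :* e)) ≈-refl (constS ½) expS expNegS ⟩
    mulS (constS ½) (addS (mulS expS expS) (mulS expNegS expS))       ≈⟨ mulS-cong {constS ½} ≈-refl (λ n → cong (mulS expS expS n +_) (expNegS*expS n)) ⟩
    mulS (constS ½) (addS (mulS expS expS) oneS)                      ∎
    where
    open SeriesSolver
    open import Relation.Binary.Reasoning.Setoid (CommutativeRing.setoid seriesCommutativeRing)

  expm1/tS*[expS+1] : mulS expm1/tS (addS expS oneS) ≈ mulS (constS (fromℕ 2)) (scaleS (fromℕ 2) expm1/tS)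
  expm1/tS*[expS+1] = begin
    mulS expm1/tS (addS expS oneS)                  ≈⟨ ≈-sym (shiftS-mulS expm1S (addS expS oneS) refl) ⟩
    shiftS (mulS expm1S (addS expS oneS))           ≈⟨ (λ n → trans (expm1S*[expS+1] (suc n)) (sym (expm1S[2t] (suc n)))) ⟩
    shiftS (scaleS (fromℕ 2) expm1S)                ≈⟨ expm1/tS[2t] ⟩
    mulS (constS (fromℕ 2)) (scaleS (fromℕ 2) expm1/tS) ∎
    where open import Relation.Binary.Reasoning.Setoid (CommutativeRing.setoid seriesCommutativeRing)

  A₁∘halfTanhS/tS : shiftS (compS (AS (ℤ.+ 1)) halfTanhS) ≈ oneS
  A₁∘halfTanhS/tS = ≈-trans (λ n → A₁∘halfTanhS≈tS (suc n)) shiftS-tS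

  -- t / tanh t = 2t / (e^{2t} - 1) + t, checked after multiplying by (sinh t / t) e^t.
  t/tanhS≈ : divS (compS (AS (ℤ.+ 1)) halfTanhS) tanhS ≈ addS (scaleS (fromℕ 2) bernoulliS) tS
  t/tanhS≈ = mulS-cancelˡ Y refl (≈-trans lhs (≈-sym rhs))
    where
    open SeriesSolver
    open import Relation.Binary.Reasoning.Setoid (CommutativeRing.setoid seriesCommutativeRing)
    Y Q B₂ W₂ : Series
    Y  = mulS (shiftS sinhS) expS
    Q  = divS (compS (AS (ℤ.+ 1)) halfTanhS) tanhS
    B₂ = scaleS (fromℕ 2) bernoulliS
    W₂ = scaleS (fromℕ 2) expm1/tS
    lhs : mulS Y Q ≈ mulS (constS ½) (addS (mulS expS expS) oneS)
    lhs = begin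
      mulS (mulS (shiftS sinhS) expS) Q                         ≈⟨ mulS-cong {Y} {mulS (mulS (shiftS tanhS) coshS) expS} {Q}
                                                                     (mulS-cong {shiftS sinhS} {mulS (shiftS tanhS) coshS} {expS} (≈-sym tanh/tS*coshS) ≈-refl) ≈-refl ⟩
      mulS (mulS (mulS (shiftS tanhS) coshS) expS) Q            ≈⟨ solve 4 (λ t c e q → ((t :* c) :* e) :* q :≈ (q :* t) :* (c :* e)) ≈-refl (shiftS tanhS) coshS expS Q ⟩
      mulS (mulS Q (shiftS tanhS)) (mulS coshS expS)            ≈⟨ mulS-cong {mulS Q (shiftS tanhS)} {oneS} {mulS coshS expS}
                                                                     (≈-trans (divS-mulS (compS (AS (ℤ.+ 1)) halfTanhS) tanhS refl) A₁∘halfTanhS/tS) ≈-refl ⟩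
      mulS oneS (mulS coshS expS)                               ≈⟨ mulS-identityˡ (mulS coshS expS) ⟩
      mulS coshS expS                                           ≈⟨ coshS*expS ⟩
      mulS (constS ½) (addS (mulS expS expS) oneS)              ∎
    rhs : mulS Y (addS B₂ tS) ≈ mulS (constS ½) (addS (mulS expS expS) oneS)
    rhs = begin
      mulS Y (addS B₂ tS)                                       ≈⟨ mulS-cong {Y} {W₂} {addS B₂ tS} sinh/tS*expS ≈-refl ⟩
      mulS W₂ (addS B₂ tS)                                      ≈⟨ solve 3 (λ w b t → w :* (b :+ t) :≈ b :* w :+ con ½ :* ((con (fromℕ 2) :* w) :* t)) ≈-refl W₂ B₂ tS ⟩
      addS (mulS B₂ W₂) (mulS (constS ½) (mulS (mulS (constS (fromℕ 2)) W₂) tS))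
                                                                ≈⟨ (λ n → cong₂ _+_ (bernoulliS[2t]*expm1/tS[2t] n)
                                                                     (mulS-cong {constS ½} ≈-refl (mulS-cong {mulS (constS (fromℕ 2)) W₂} {mulS expm1/tS (addS expS oneS)} {tS}
                                                                       (≈-sym expm1/tS*[expS+1]) ≈-refl) n)) ⟩
      addS oneS (mulS (constS ½) (mulS (mulS expm1/tS (addS expS oneS)) tS))
                                                                ≈⟨ (λ n → cong (oneS n +_) (mulS-cong {constS ½} ≈-refl
                                                                     (solve 3 (λ w a t → (w :* a) :* t :≈ (t :* w) :* a) ≈-refl expm1/tS (addS expS oneS) tS) n)) ⟩
      addS oneS (mulS (constS ½) (mulS (mulS tS expm1/tS) (addS expS oneS)))
                                                                ≈⟨ (λ n → cong (oneS n +_) (mulS-cong {constS ½} ≈-refl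
                                                                     (≈-trans (mulS-cong {mulS tS expm1/tS} {expm1S} {addS expS oneS} (tS*shiftS expm1S refl) ≈-refl) expm1S*[expS+1]) n)) ⟩
      addS oneS (mulS (constS ½) (subS (mulS expS expS) oneS))  ≈⟨ solve 2 (λ e o → o :+ con ½ :* (e :- o) :≈ con ½ :* (e :+ o)) ≈-refl (mulS expS expS) oneS ⟩
      mulS (constS ½) (addS (mulS expS expS) oneS)              ∎

  -- t / sinh t = 2 · t/(e^t - 1) - 2t/(e^{2t} - 1), checked after multiplying by (sinh t / t) e^t.
  t/sinhS≈ : divS (compS (AS (ℤ.+ 1)) halfTanhS) sinhS
             ≈ subS (mulS (constS (fromℕ 2)) bernoulliS) (scaleS (fromℕ 2) bernoulliS)
  t/sinhS≈ = mulS-cancelˡ Y refl (≈-trans lhs (≈-sym rhs))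
    where
    open SeriesSolver
    open import Relation.Binary.Reasoning.Setoid (CommutativeRing.setoid seriesCommutativeRing)
    Y P B₂ W₂ R : Series
    Y  = mulS (shiftS sinhS) expS
    P  = divS (compS (AS (ℤ.+ 1)) halfTanhS) sinhS
    B₂ = scaleS (fromℕ 2) bernoulliS
    W₂ = scaleS (fromℕ 2) expm1/tS
    R  = subS (mulS (constS (fromℕ 2)) bernoulliS) B₂
    lhs : mulS Y P ≈ expS
    lhs = begin
      mulS (mulS (shiftS sinhS) expS) P                         ≈⟨ solve 3 (λ s e p → (s :* e) :* p :≈ (p :* s) :* e) ≈-refl (shiftS sinhS) expS P ⟩
      mulS (mulS P (shiftS sinhS)) expS                         ≈⟨ mulS-cong {mulS P (shiftS sinhS)} {oneS} {expS}
                                                                     (≈-trans (divS-mulS (compS (AS (ℤ.+ 1)) halfTanhS) sinhS refl) A₁∘halfTanhS/tS) ≈-refl ⟩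
      mulS oneS expS                                            ≈⟨ mulS-identityˡ expS ⟩
      expS                                                      ∎
    rhs : mulS Y R ≈ expS
    rhs = begin
      mulS Y R                                                  ≈⟨ mulS-cong {Y} {W₂} {R} sinh/tS*expS ≈-refl ⟩
      mulS W₂ R                                                 ≈⟨ solve 3 (λ w b c → w :* (con (fromℕ 2) :* b :- c) :≈ b :* (con (fromℕ 2) :* w) :- c :* w) ≈-refl W₂ bernoulliS B₂ ⟩
      subS (mulS bernoulliS (mulS (constS (fromℕ 2)) W₂)) (mulS B₂ W₂)
                                                                ≈⟨ (λ n → cong₂ _-_ (mulS-cong {bernoulliS} ≈-refl (≈-sym expm1/tS*[expS+1]) n) (bernoulliS[2t]*expm1/tS[2t] n)) ⟩
      subS (mulS bernoulliS (mulS expm1/tS (addS expS oneS))) oneS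
                                                                ≈⟨ (λ n → cong (_- oneS n) (trans (sym (mulS-assoc bernoulliS expm1/tS (addS expS oneS) n))
                                                                     (trans (mulS-cong {mulS bernoulliS expm1/tS} {oneS} {addS expS oneS} bernoulliS*expm1/tS ≈-refl n)
                                                                       (mulS-identityˡ (addS expS oneS) n)))) ⟩
      subS (addS expS oneS) oneS                                ≈⟨ solve 2 (λ e o → (e :+ o) :- o :≈ e) ≈-refl expS oneS ⟩
      expS                                                      ∎

  -- 2t / (e^t + 1) = 2 · t/(e^t - 1) - 2 · 2t/(e^{2t} - 1), checked after multiplying by (e^t - 1)/t.
  genocchiS*[expS+1] : mulS genocchiS (addS expS oneS) ≈ mulS (constS (fromℕ 2)) tS
  genocchiS*[expS+1] = mulS-cancelˡ expm1/tS refl (≈-trans lhs (≈-sym rhs))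
    where
    open SeriesSolver
    open import Relation.Binary.Reasoning.Setoid (CommutativeRing.setoid seriesCommutativeRing)
    B₂ W₂ two : Series
    B₂  = scaleS (fromℕ 2) bernoulliS
    W₂  = scaleS (fromℕ 2) expm1/tS
    two = constS (fromℕ 2)
    bernoulliS*expm1/tS*[expS+1] : mulS bernoulliS (mulS expm1/tS (addS expS oneS)) ≈ addS expS oneS
    bernoulliS*expm1/tS*[expS+1] n = trans (sym (mulS-assoc bernoulliS expm1/tS (addS expS oneS) n))
      (trans (mulS-cong {mulS bernoulliS expm1/tS} {oneS} {addS expS oneS} bernoulliS*expm1/tS ≈-refl n)
        (mulS-identityˡ (addS expS oneS) n))
    lhs : mulS expm1/tS (mulS genocchiS (addS expS oneS)) ≈ mulS two expm1S
    lhs = begin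
      mulS expm1/tS (mulS genocchiS (addS expS oneS))           ≈⟨ solve 3 (λ w g a → w :* (g :* a) :≈ (w :* a) :* g) ≈-refl expm1/tS genocchiS (addS expS oneS) ⟩
      mulS (mulS expm1/tS (addS expS oneS)) genocchiS           ≈⟨ mulS-cong {mulS expm1/tS (addS expS oneS)} {mulS two W₂} {genocchiS} expm1/tS*[expS+1] ≈-refl ⟩
      mulS (mulS two W₂) genocchiS                              ≈⟨ solve 3 (λ w b c → (con (fromℕ 2) :* w) :* (con (fromℕ 2) :* b :- con (fromℕ 2) :* c)
                                                                     :≈ con (fromℕ 2) :* (b :* (con (fromℕ 2) :* w)) :- con (fromℕ 2) :* con (fromℕ 2) :* (c :* w)) ≈-refl W₂ bernoulliS B₂ ⟩
      subS (mulS two (mulS bernoulliS (mulS two W₂))) (mulS (mulS two two) (mulS B₂ W₂))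
                                                                ≈⟨ (λ n → cong₂ _-_ (mulS-cong {two} ≈-refl (≈-trans (mulS-cong {bernoulliS} ≈-refl (≈-sym expm1/tS*[expS+1])) bernoulliS*expm1/tS*[expS+1]) n)
                                                                     (mulS-cong {mulS two two} ≈-refl bernoulliS[2t]*expm1/tS[2t] n)) ⟩
      subS (mulS two (addS expS oneS)) (mulS (mulS two two) oneS)
                                                                ≈⟨ solve 2 (λ e o → con (fromℕ 2) :* (e :+ o) :- (con (fromℕ 2) :* con (fromℕ 2)) :* o :≈ con (fromℕ 2) :* (e :- o)) ≈-refl expS oneS ⟩
      mulS two expm1S                                           ∎
    rhs : mulS expm1/tS (mulS two tS) ≈ mulS two expm1S
    rhs = begin
      mulS expm1/tS (mulS two tS)                               ≈⟨ solve 2 (λ w t → w :* (con (fromℕ 2) :* t) :≈ con (fromℕ 2) :* (t :* w)) ≈-refl expm1/tS tS ⟩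
      mulS two (mulS tS expm1/tS)                               ≈⟨ mulS-cong {two} ≈-refl (tS*shiftS expm1S refl) ⟩
      mulS two expm1S                                           ∎

  fromℕ-2^ : ∀ k → fromℕ 2 ^ℚ k ≡ fromℕ (2 ^ k)
  fromℕ-2^ zero    = refl
  fromℕ-2^ (suc k) = trans (cong (fromℕ 2 *_) (fromℕ-2^ k)) (sym (fromℕ-* 2 (2 ^ k)))

  tS-vanishes : ∀ {N} → 2 ≤ N → tS N ≡ 0ℚ
  tS-vanishes {suc zero}    (s≤s ())
  tS-vanishes {suc (suc _)} _ = refl

  polycotangent≡ : ∀ N → 2 ≤ N → polycotangent (ℤ.+ 1) N ≡ bernoulli N * fromℕ 2 ^ℚ N
  polycotangent≡ N 2≤N = begin
    fromℕ (N !) * divS (compS (AS (ℤ.+ 1)) halfTanhS) tanhS N   ≡⟨ cong (fromℕ (N !) *_) (t/tanhS≈ N) ⟩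
    fromℕ (N !) * (bernoulliS N * fromℕ 2 ^ℚ N + tS N)          ≡⟨ cong (λ v → fromℕ (N !) * (bernoulliS N * fromℕ 2 ^ℚ N + v)) (tS-vanishes 2≤N) ⟩
    fromℕ (N !) * (bernoulliS N * fromℕ 2 ^ℚ N + 0ℚ)            ≡⟨ solve 3 (λ f b c → f :* (b :* c :+ con 0ℚ) := f :* b :* c) refl
                                                                      (fromℕ (N !)) (bernoulliS N) (fromℕ 2 ^ℚ N) ⟩
    bernoulli N * fromℕ 2 ^ℚ N                                   ∎
    where
    open ≡-Reasoning
    open ℚ-Solver

  polycosecant≡ : ∀ N → polycosecant (ℤ.+ 1) N ≡ bernoulli N * (fromℕ 2 - fromℕ 2 ^ℚ N)
  polycosecant≡ N = begin
    fromℕ (N !) * divS (compS (AS (ℤ.+ 1)) halfTanhS) sinhS N                       ≡⟨ cong (fromℕ (N !) *_) (t/sinhS≈ N) ⟩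
    fromℕ (N !) * (mulS (constS (fromℕ 2)) bernoulliS N - bernoulliS N * fromℕ 2 ^ℚ N) ≡⟨ cong (λ v → fromℕ (N !) * (v - bernoulliS N * fromℕ 2 ^ℚ N))
                                                                                          (mulS-constS (fromℕ 2) bernoulliS N) ⟩
    fromℕ (N !) * (fromℕ 2 * bernoulliS N - bernoulliS N * fromℕ 2 ^ℚ N)            ≡⟨ solve 4 (λ f b t c → f :* (t :* b :- b :* c) := f :* b :* (t :- c)) refl
                                                                                          (fromℕ (N !)) (bernoulliS N) (fromℕ 2) (fromℕ 2 ^ℚ N) ⟩
    bernoulli N * (fromℕ 2 - fromℕ 2 ^ℚ N)                                          ∎
    where
    open ≡-Reasoning
    open ℚ-Solver

  genocchi≡ : ∀ N → egfCoeff genocchiS N ≡ bernoulli N * (fromℕ 2 - fromℕ 2 * fromℕ 2 ^ℚ N)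
  genocchi≡ N = begin
    fromℕ (N !) * (mulS (constS (fromℕ 2)) bernoulliS N - mulS (constS (fromℕ 2)) (scaleS (fromℕ 2) bernoulliS) N)
      ≡⟨ cong₂ (λ u v → fromℕ (N !) * (u - v)) (mulS-constS (fromℕ 2) bernoulliS N) (mulS-constS (fromℕ 2) (scaleS (fromℕ 2) bernoulliS) N) ⟩
    fromℕ (N !) * (fromℕ 2 * bernoulliS N - fromℕ 2 * (bernoulliS N * fromℕ 2 ^ℚ N))
      ≡⟨ solve 4 (λ f b t c → f :* (t :* b :- t :* (b :* c)) := f :* b :* (t :- t :* c)) refl
           (fromℕ (N !)) (bernoulliS N) (fromℕ 2) (fromℕ 2 ^ℚ N) ⟩
    bernoulli N * (fromℕ 2 - fromℕ 2 * fromℕ 2 ^ℚ N) ∎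
    where
    open ≡-Reasoning
    open ℚ-Solver

  2^≡2+[2^∸2] : ∀ N → 1 ≤ N → fromℕ 2 ^ℚ N ≡ fromℕ 2 + fromℕ (2 ^ N ∸ 2)
  2^≡2+[2^∸2] N@(suc N′) _ = trans (fromℕ-2^ N)
    (trans (cong fromℕ (sym (ℕ.m+[n∸m]≡n (ℕ.*-monoʳ-≤ 2 (ℕ.m^n>0 2 N′))))) (fromℕ-+ 2 (2 ^ N ∸ 2)))

  polycosecant≡-bernoulli*[2^∸2] : ∀ N → 1 ≤ N → polycosecant (ℤ.+ 1) N ≡ - (bernoulli N * fromℕ (2 ^ N ∸ 2))
  polycosecant≡-bernoulli*[2^∸2] N 1≤N =
    trans (polycosecant≡ N) (trans (cong (λ v → bernoulli N * (fromℕ 2 - v)) (2^≡2+[2^∸2] N 1≤N))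
      (solve 2 (λ x a → x :* (con (fromℕ 2) :- (con (fromℕ 2) :+ a)) := :- (x :* a)) refl (bernoulli N) (fromℕ (2 ^ N ∸ 2))))
    where open ℚ-Solver

  neg-genocchi≡bernoulli*2[1+[2^∸2]] : ∀ N → 1 ≤ N → - egfCoeff genocchiS N ≡ bernoulli N * fromℕ (2 ℕ.* suc (2 ^ N ∸ 2))
  neg-genocchi≡bernoulli*2[1+[2^∸2]] N 1≤N = begin
    - egfCoeff genocchiS N                               ≡⟨ cong -_ (trans (genocchi≡ N) (cong (λ v → x * (fromℕ 2 - fromℕ 2 * v)) (2^≡2+[2^∸2] N 1≤N))) ⟩
    - (x * (fromℕ 2 - fromℕ 2 * (fromℕ 2 + fromℕ a)))    ≡⟨ solve 2 (λ x a → :- (x :* (con (fromℕ 2) :- con (fromℕ 2) :* (con (fromℕ 2) :+ a)))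
                                                              := x :* (con (fromℕ 2) :* (con 1ℚ :+ a))) refl x (fromℕ a) ⟩
    x * (fromℕ 2 * (1ℚ + fromℕ a))                       ≡⟨ cong (x *_) (trans (fromℕ-* 2 (suc a)) (cong (fromℕ 2 *_) (fromℕ-suc a))) ⟨
    x * fromℕ (2 ℕ.* suc a)                              ∎
    where
    open ≡-Reasoning
    open ℚ-Solver
    x = bernoulli N
    a = 2 ^ N ∸ 2

  -- t / (e^t - 1) = log(1 + x) / x at x = e^t - 1

  log1pS : Series
  log1pS zero    = 0ℚ
  log1pS (suc k) = sgn k * 1/[1+ k ]

  log1p/xS : Series
  log1p/xS = shiftS log1pS

  expS≈1+expm1S : expS ≈ addS oneS expm1S
  expS≈1+expm1S n = sym (solve 2 (λ o e → o :+ (e :- o) := e) refl (oneS n) (expS n))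
    where open ℚ-Solver

  ∂-expm1S : ∂ expm1S ≈ expS
  ∂-expm1S n = trans (cong (fromℕ (suc n) *_) (+-identityʳ (expS (suc n)))) (∂-expS n)

  ∂-log1pS : ∂ log1pS ≈ sgn
  ∂-log1pS k = trans
    (solve 3 (λ i s r → i :* (s :* r) := s :* (i :* r)) refl (fromℕ (suc k)) (sgn k) 1/[1+ k ])
    (trans (cong (sgn k *_) (fromℕ-suc*1/[1+n] k)) (*-identityʳ (sgn k)))
    where open ℚ-Solver

  -- sgn is the series of 1 / (1 + x), so this says 1 / (1 + (e^t - 1)) = e^{-t}.
  sgn∘expm1S*expS : mulS (compS sgn expm1S) expS ≈ oneS
  sgn∘expm1S*expS n = begin
    mulS C expS n                                               ≡⟨ mulS-cong {C} ≈-refl expS≈1+expm1S n ⟩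
    mulS C (addS oneS expm1S) n                                 ≡⟨ mulS-distribˡ oneS expm1S C n ⟩
    mulS C oneS n + mulS C expm1S n                             ≡⟨ cong₂ _+_ (mulS-identityʳ C n) (mulS-compS sgn expm1S expm1S refl n) ⟩
    C n + sumTo n (λ k → sgn k * mulS (powS expm1S k) expm1S n)  ≡⟨ cong (C n +_) (trans (sumTo-cong n (λ k → trans (cong (sgn k *_) (powS-suc expm1S k n)) (sym (alternate k))))
                                                                                     (sym (sumTo-neg n (λ k → b (suc k))))) ⟩
    sumTo n b - sumTo n (λ k → b (suc k))                       ≡⟨ sumTo-telescope n b ⟩
    b 0 - b (suc n)                                             ≡⟨ cong₂ _-_ (*-identityˡ (oneS n))
                                                                     (trans (cong (sgn (suc n) *_) (powS-vanishes expm1S refl {suc n} ℕ.≤-refl)) (*-zeroʳ (sgn (suc n)))) ⟩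
    oneS n - 0ℚ                                                 ≡⟨ +-identityʳ (oneS n) ⟩
    oneS n                                                      ∎
    where
    open ≡-Reasoning
    C = compS sgn expm1S
    b : ℕ → ℚ
    b k = sgn k * powS expm1S k n
    alternate : ∀ k → - b (suc k) ≡ sgn k * powS expm1S (suc k) n
    alternate k = solve 2 (λ s x → :- ((con (- 1ℚ) :* s) :* x) := s :* x) refl (sgn k) (powS expm1S (suc k) n)
      where open ℚ-Solver

  log1pS∘expm1S≈tS : compS log1pS expm1S ≈ tS
  log1pS∘expm1S≈tS = ∂-injective {compS log1pS expm1S} {tS} refl (λ n → begin
    ∂ (compS log1pS expm1S) n                      ≡⟨ ∂-compS log1pS expm1S refl n ⟩
    mulS (compS (∂ log1pS) expm1S) (∂ expm1S) n    ≡⟨ mulS-cong {compS (∂ log1pS) expm1S} {compS sgn expm1S}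
                                                        (compS-cong {∂ log1pS} {sgn} {expm1S} ∂-log1pS ≈-refl) ∂-expm1S n ⟩
    mulS (compS sgn expm1S) expS n                 ≡⟨ sgn∘expm1S*expS n ⟩
    oneS n                                         ≡⟨ ∂-tS n ⟨
    ∂ tS n                                         ∎)
    where open ≡-Reasoning

  log1p/xS∘expm1S*expm1S : mulS (compS log1p/xS expm1S) expm1S ≈ compS log1pS expm1S
  log1p/xS∘expm1S*expm1S zero    = trans (mulS-compS log1p/xS expm1S expm1S refl 0)
    (trans (cong (log1p/xS 0 *_) (powS-vanishes expm1S refl {1} {0} (s≤s z≤n))) (*-zeroʳ (log1p/xS 0)))
  log1p/xS∘expm1S*expm1S (suc m) = begin
    mulS (compS log1p/xS expm1S) expm1S n                               ≡⟨ mulS-compS log1p/xS expm1S expm1S refl n ⟩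
    sumTo n (λ k → log1p/xS k * mulS (powS expm1S k) expm1S n)          ≡⟨ sumTo-cong n (λ k → cong (log1p/xS k *_) (powS-suc expm1S k n)) ⟩
    sumTo m (λ k → log1pS (suc k) * powS expm1S (suc k) n) + log1p/xS n * powS expm1S (suc n) n
                                                                        ≡⟨ cong (sumTo m (λ k → log1pS (suc k) * powS expm1S (suc k) n) +_)
                                                                             (trans (cong (log1p/xS n *_) (powS-vanishes expm1S refl {suc n} ℕ.≤-refl)) (*-zeroʳ (log1p/xS n))) ⟩
    sumTo m (λ k → log1pS (suc k) * powS expm1S (suc k) n) + 0ℚ         ≡⟨ +-identityʳ _ ⟩
    sumTo m (λ k → log1pS (suc k) * powS expm1S (suc k) n)              ≡⟨ +-identityˡ _ ⟨
    0ℚ + sumTo m (λ k → log1pS (suc k) * powS expm1S (suc k) n)         ≡⟨ cong (_+ sumTo m (λ k → log1pS (suc k) * powS expm1S (suc k) n)) (*-zeroˡ (oneS n)) ⟨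
    log1pS 0 * powS expm1S 0 n + sumTo m (λ k → log1pS (suc k) * powS expm1S (suc k) n)
                                                                        ≡⟨ sumTo-unfoldˡ m (λ k → log1pS k * powS expm1S k n) ⟨
    compS log1pS expm1S n                                               ∎
    where
    open ≡-Reasoning
    n = suc m

  bernoulliS≈log1p/xS∘expm1S : bernoulliS ≈ compS log1p/xS expm1S
  bernoulliS≈log1p/xS∘expm1S = mulS-cancelˡ expm1/tS refl (λ n → trans (mulS-comm expm1/tS bernoulliS n)
    (trans (bernoulliS*expm1/tS n) (sym (expm1/tS*log1p/xS∘expm1S n))))
    where
    expm1/tS*log1p/xS∘expm1S : mulS expm1/tS (compS log1p/xS expm1S) ≈ oneS
    expm1/tS*log1p/xS∘expm1S n =
      trans (sym (shiftS-mulS expm1S (compS log1p/xS expm1S) refl n))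
        (trans (mulS-comm expm1S (compS log1p/xS expm1S) (suc n))
          (trans (log1p/xS∘expm1S*expm1S (suc n)) (trans (log1pS∘expm1S≈tS (suc n)) (shiftS-tS n))))

  powS-expm1S-recurrence : ∀ k N →
    fromℕ (suc N) * powS expm1S (suc k) (suc N) ≡ fromℕ (suc k) * (powS expm1S k N + powS expm1S (suc k) N)
  powS-expm1S-recurrence k N = trans (∂-powS expm1S k N) (cong (fromℕ (suc k) *_)
    (trans (mulS-cong {powS expm1S k} ≈-refl (≈-trans ∂-expm1S expS≈1+expm1S) N)
      (trans (mulS-distribˡ oneS expm1S (powS expm1S k) N)
        (cong₂ _+_ (mulS-identityʳ (powS expm1S k) N) (powS-suc expm1S k N)))))

  -- N! [t^N] (e^t - 1)^k = k! S(N, k)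
  stirling-integrality : ∀ N k → Σ ℤ λ z → fromℕ (N !) * powS expm1S k N ≡ fromℕ (k !) * fromℤ z
  stirling-integrality zero    zero    = ℤ.+ 1 , refl
  stirling-integrality zero    (suc k) = ℤ.+ 0 , trans (cong (fromℕ 1 *_) (powS-vanishes expm1S refl {suc k} {0} (s≤s z≤n)))
    (trans (*-zeroʳ (fromℕ 1)) (sym (*-zeroʳ (fromℕ (suc k !)))))
  stirling-integrality (suc N) zero    = ℤ.+ 0 , trans (*-zeroʳ (fromℕ (suc N !))) (sym (*-zeroʳ (fromℕ 1)))
  stirling-integrality (suc N) (suc k) with stirling-integrality N k | stirling-integrality N (suc k)
  ... | z₁ , eq₁ | z₂ , eq₂ = z₁ ℤ.+ ℤ.+ suc k ℤ.* z₂ , (begin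
    fromℕ (suc N !) * powS expm1S (suc k) (suc N)
      ≡⟨ cong (_* powS expm1S (suc k) (suc N)) (fromℕ-* (suc N) (N !)) ⟩
    fromℕ (suc N) * fromℕ (N !) * powS expm1S (suc k) (suc N)
      ≡⟨ solve 3 (λ a b c → a :* b :* c := b :* (a :* c)) refl (fromℕ (suc N)) (fromℕ (N !)) (powS expm1S (suc k) (suc N)) ⟩
    fromℕ (N !) * (fromℕ (suc N) * powS expm1S (suc k) (suc N))
      ≡⟨ cong (fromℕ (N !) *_) (powS-expm1S-recurrence k N) ⟩
    fromℕ (N !) * (s * (powS expm1S k N + powS expm1S (suc k) N))
      ≡⟨ solve 4 (λ f s a b → f :* (s :* (a :+ b)) := s :* (f :* a) :+ s :* (f :* b)) refl (fromℕ (N !)) s (powS expm1S k N) (powS expm1S (suc k) N) ⟩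
    s * (fromℕ (N !) * powS expm1S k N) + s * (fromℕ (N !) * powS expm1S (suc k) N)
      ≡⟨ cong₂ (λ u v → s * u + s * v) eq₁ eq₂ ⟩
    s * (fromℕ (k !) * fromℤ z₁) + s * (fromℕ (suc k !) * fromℤ z₂)
      ≡⟨ cong (λ v → s * (fromℕ (k !) * fromℤ z₁) + s * (v * fromℤ z₂)) (fromℕ-* (suc k) (k !)) ⟩
    s * (fromℕ (k !) * fromℤ z₁) + s * (s * fromℕ (k !) * fromℤ z₂)
      ≡⟨ solve 4 (λ s f a b → s :* (f :* a) :+ s :* (s :* f :* b) := (s :* f) :* (a :+ s :* b)) refl s (fromℕ (k !)) (fromℤ z₁) (fromℤ z₂) ⟩
    s * fromℕ (k !) * (fromℤ z₁ + s * fromℤ z₂)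
      ≡⟨ cong₂ _*_ (fromℕ-* (suc k) (k !)) (trans (fromℤ-+ z₁ _) (cong (fromℤ z₁ +_) (fromℤ-* (ℤ.+ suc k) z₂))) ⟨
    fromℕ (suc k !) * fromℤ (z₁ ℤ.+ ℤ.+ suc k ℤ.* z₂) ∎)
    where
    open ≡-Reasoning
    open ℚ-Solver
    s = fromℕ (suc k)

  *-∣-! : ∀ {a b k} → 0 < a → a < b → b ≤ k → a ℕ.* b ∣ k !
  *-∣-! {suc a} {suc b} _ (s≤s a<b) b≤k = ∣-trans
    (subst (_∣ suc b !) (ℕ.*-comm (suc b) (suc a))
      (*-monoʳ-∣ (suc b) (∣-trans (m∣m*n (a !)) (m≤n⇒m!∣n! a<b))))
    (m≤n⇒m!∣n! b≤k)

  distinct-factors-∣-! : ∀ {a b k} → 1 < a → a < b → suc k ≡ a ℕ.* b → suc k ∣ k !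
  distinct-factors-∣-! {a} {b} {k} 1<a a<b eq = subst (_∣ k !) (sym eq) (*-∣-! (ℕ.<-trans (s≤s z≤n) 1<a) a<b b≤k)
    where
    b≤k : b ≤ k
    b≤k = ℕ.<⇒≤pred (subst (b <_) (trans (ℕ.*-comm b a) (sym eq))
      (ℕ.m<m*n b a {{ℕ.>-nonZero (ℕ.<-trans (ℕ.<-trans (s≤s z≤n) 1<a) a<b)}} 1<a))

  square-∣-2*! : ∀ {d k} → 1 < d → suc k ≡ d ℕ.* d → suc k ∣ 2 ℕ.* k !
  square-∣-2*! {suc zero}             (s≤s ())
  square-∣-2*! {suc (suc zero)}       _ refl = divides 3 refl
  square-∣-2*! {d@(suc (suc (suc _)))} {k} _ eq =
    ∣n⇒∣m*n 2 (m*n∣⇒n∣ 2 (suc k) (subst (_∣ k !) d*2d≡2[1+k] (*-∣-! (s≤s z≤n) d<2d 2d≤k)))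
    where
    d<2d : d < 2 ℕ.* d
    d<2d = subst (d <_) (ℕ.*-comm d 2) (ℕ.m<m*n d 2 (s≤s (s≤s z≤n)))
    2d≤k : 2 ℕ.* d ≤ k
    2d≤k = ℕ.<⇒≤pred (subst (2 ℕ.* d <_) (sym eq) (ℕ.*-monoˡ-< d {2} {d} (s≤s (s≤s (s≤s z≤n)))))
    d*2d≡2[1+k] : d ℕ.* (2 ℕ.* d) ≡ 2 ℕ.* suc k
    d*2d≡2[1+k] = trans (solve 1 (λ x → x :* (con 2 :* x) := con 2 :* (x :* x)) refl d) (cong (2 ℕ.*_) (sym eq))
      where open ℕ-Solver

  -- The factor 2 is needed only for k + 1 = 4.
  composite-∣-2*! : ∀ k → Composite (suc k) → suc k ∣ 2 ℕ.* k !
  composite-∣-2*! k (composite {d} d<1+k (divides e eq)) with ℕ.<-cmp d e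
  ... | tri< d<e _ _ = ∣n⇒∣m*n 2 (distinct-factors-∣-! 1<d d<e (trans eq (ℕ.*-comm e d)))
    where 1<d = ℕ.nonTrivial⇒n>1 d
  ... | tri> _ _ e<d = ∣n⇒∣m*n 2 (distinct-factors-∣-! (1<e e eq) e<d eq)
    where
    1<e : ∀ e → suc k ≡ e ℕ.* d → 1 < e
    1<e (suc zero)     eq₁ = ⊥-elim (ℕ.<-irrefl (trans (sym (ℕ.+-identityʳ d)) (sym eq₁)) d<1+k)
    1<e (suc (suc _))  _   = s≤s (s≤s z≤n)
  ... | tri≈ _ refl _ = square-∣-2*! (ℕ.nonTrivial⇒n>1 d) eq

  ord-≡0 : ∀ p d → ¬ p ∣ d → ord p d ≡ 0
  ord-≡0 zero    d       _   = refl
  ord-≡0 (suc q) zero    p∤0 = ⊥-elim (p∤0 (suc q ∣0))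
  ord-≡0 (suc q) (suc k) p∤d with suc q ∣? suc k
  ... | yes p∣d = ⊥-elim (p∤d p∣d)
  ... | no  _   = refl

  ord-≡1 : ∀ {p d} → Prime p → p ∣ d → ¬ p ℕ.* p ∣ d → ord p d ≡ 1
  ord-≡1 {zero}                      p-prime _   _    = ⊥-elim (¬prime[0] p-prime)
  ord-≡1 {suc q} {zero}              _       _   p²∤0 = ⊥-elim (p²∤0 (_ ∣0))
  ord-≡1 {suc q} {suc zero}          p-prime p∣1 _    = ⊥-elim (¬prime[1] (subst Prime (∣1⇒≡1 p∣1) p-prime))
  ord-≡1 {p@(suc q)} {d@(suc (suc k))} _     p∣d p²∤d with p ∣? d
  ... | no p∤d = ⊥-elim (p∤d p∣d)
  ... | yes _ with d ℕ./ p in d/p≡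
  ...   | zero  = ⊥-elim (ℕ.0≢1+n (trans (cong (ℕ._* p) (sym d/p≡)) (m/n*n≡m p∣d)))
  ...   | suc y with p ∣? suc y
  ...     | yes p∣d/p = ⊥-elim (p²∤d (subst (p ℕ.* p ∣_) (m/n*n≡m p∣d) (*-monoˡ-∣ p (subst (p ∣_) (sym d/p≡) p∣d/p))))
  ...     | no  _     = refl

  den-neg : ∀ r → den (- r) ≡ den r
  den-neg r = ℤ.+-injective (↧-neg r)

  -- p-integral rationals

  record PIntegral (p : ℕ) (q : ℚ) : Set where
    constructor pIntegral
    field
      denominator   : ℕ
      numerator     : ℤ
      p∤denominator : ¬ p ∣ denominator
      clears        : q * fromℕ denominator ≡ fromℤ numerator

  *-den≡↥ : ∀ q → q * fromℕ (den q) ≡ fromℤ (↥ q)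
  *-den≡↥ q@(ℚ.mkℚ n d _) = toℚᵘ-injective (ℚᵘ.≃-trans (toℚᵘ-homo-* q (fromℕ (suc d)))
    (ℚᵘ.≃-trans (ℚᵘ.*-cong (ℚᵘ.≃-refl {ℚᵘ.mkℚᵘ n d}) (toℚᵘ-/ (ℤ.+ suc d) 0))
      (ℚᵘ.≃-trans (ℚᵘ.*≡* eq) (ℚᵘ.≃-sym (toℚᵘ-/ n 0)))))
    where
    eq : (n ℤ.* ℤ.+ suc d) ℤ.* ℤ.+ 1 ≡ n ℤ.* ℤ.+ suc (d ℕ.* 1)
    eq = trans (ℤ.*-identityʳ _) (cong (λ v → n ℤ.* ℤ.+ suc v) (sym (ℕ.*-identityʳ d)))

  den-∣ : ∀ q (b a : ℤ) → q * fromℤ b ≡ fromℤ a → den q ∣ ℤ.∣ b ∣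
  den-∣ q@(ℚ.mkℚ n d coprime) b a eq = Coprimality.coprime-divisor (Coprimality.sym n⊥d) (divides ℤ.∣ a ∣ (begin
    ℤ.∣ n ∣ ℕ.* ℤ.∣ b ∣                ≡⟨ ℤ.abs-* n b ⟨
    ℤ.∣ n ℤ.* b ∣                      ≡⟨ cong ℤ.∣_∣ (ℤ.*-identityʳ (n ℤ.* b)) ⟨
    ℤ.∣ (n ℤ.* b) ℤ.* ℤ.+ 1 ∣          ≡⟨ cong ℤ.∣_∣ cross ⟩
    ℤ.∣ a ℤ.* ℤ.+ suc (d ℕ.* 1) ∣      ≡⟨ ℤ.abs-* a (ℤ.+ suc (d ℕ.* 1)) ⟩
    ℤ.∣ a ∣ ℕ.* suc (d ℕ.* 1)          ≡⟨ cong (λ v → ℤ.∣ a ∣ ℕ.* suc v) (ℕ.*-identityʳ d) ⟩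
    ℤ.∣ a ∣ ℕ.* suc d                  ∎))
    where
    open ≡-Reasoning
    n⊥d : Coprimality.Coprime ℤ.∣ n ∣ (suc d)
    n⊥d = recompute (Coprimality.coprime? ℤ.∣ n ∣ (suc d)) coprime
    cross : (n ℤ.* b) ℤ.* ℤ.+ 1 ≡ a ℤ.* ℤ.+ suc (d ℕ.* 1)
    cross with ℚᵘ.≃-trans (ℚᵘ.≃-sym (ℚᵘ.≃-trans (toℚᵘ-homo-* q (fromℤ b)) (ℚᵘ.*-cong (ℚᵘ.≃-refl {ℚᵘ.mkℚᵘ n d}) (toℚᵘ-/ b 0))))
                          (ℚᵘ.≃-trans (toℚᵘ-cong eq) (toℚᵘ-/ a 0))
    ... | ℚᵘ.*≡* x = x

  module _ {p : ℕ} (p-prime : Prime p) where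

    p∤1 : ¬ p ∣ 1
    p∤1 p∣1 = ¬prime[1] (subst Prime (∣1⇒≡1 p∣1) p-prime)

    p∤* : ∀ {m n} → ¬ p ∣ m → ¬ p ∣ n → ¬ p ∣ m ℕ.* n
    p∤* p∤m p∤n p∣mn = [ p∤m , p∤n ]′ (euclidsLemma _ _ p-prime p∣mn)

    fromℤ-pIntegral : ∀ a → PIntegral p (fromℤ a)
    fromℤ-pIntegral a = pIntegral 1 a p∤1 (*-identityʳ (fromℤ a))

    fromℕ-pIntegral : ∀ m → PIntegral p (fromℕ m)
    fromℕ-pIntegral m = fromℤ-pIntegral (ℤ.+ m)

    +-pIntegral : ∀ {q r} → PIntegral p q → PIntegral p r → PIntegral p (q + r)
    +-pIntegral {q} {r} (pIntegral m a p∤m eq) (pIntegral m′ b p∤m′ eq′) =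
      pIntegral (m ℕ.* m′) (a ℤ.* ℤ.+ m′ ℤ.+ b ℤ.* ℤ.+ m) (p∤* p∤m p∤m′) (begin
        (q + r) * fromℕ (m ℕ.* m′)                    ≡⟨ cong ((q + r) *_) (fromℕ-* m m′) ⟩
        (q + r) * (fromℕ m * fromℕ m′)                ≡⟨ solve 4 (λ x y u v → (x :+ y) :* (u :* v) := x :* u :* v :+ y :* v :* u) refl q r (fromℕ m) (fromℕ m′) ⟩
        q * fromℕ m * fromℕ m′ + r * fromℕ m′ * fromℕ m ≡⟨ cong₂ (λ x y → x * fromℕ m′ + y * fromℕ m) eq eq′ ⟩
        fromℤ a * fromℕ m′ + fromℤ b * fromℕ m        ≡⟨ cong₂ _+_ (fromℤ-* a (ℤ.+ m′)) (fromℤ-* b (ℤ.+ m)) ⟨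
        fromℤ (a ℤ.* ℤ.+ m′) + fromℤ (b ℤ.* ℤ.+ m)    ≡⟨ fromℤ-+ (a ℤ.* ℤ.+ m′) (b ℤ.* ℤ.+ m) ⟨
        fromℤ (a ℤ.* ℤ.+ m′ ℤ.+ b ℤ.* ℤ.+ m)          ∎)
      where
      open ≡-Reasoning
      open ℚ-Solver

    *-pIntegral : ∀ {q r} → PIntegral p q → PIntegral p r → PIntegral p (q * r)
    *-pIntegral {q} {r} (pIntegral m a p∤m eq) (pIntegral m′ b p∤m′ eq′) =
      pIntegral (m ℕ.* m′) (a ℤ.* b) (p∤* p∤m p∤m′) (begin
      q * r * fromℕ (m ℕ.* m′)              ≡⟨ cong (q * r *_) (fromℕ-* m m′) ⟩
      q * r * (fromℕ m * fromℕ m′)          ≡⟨ solve 4 (λ x y u v → x :* y :* (u :* v) := x :* u :* (y :* v)) refl q r (fromℕ m) (fromℕ m′) ⟩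
      q * fromℕ m * (r * fromℕ m′)          ≡⟨ cong₂ _*_ eq eq′ ⟩
      fromℤ a * fromℤ b                     ≡⟨ fromℤ-* a b ⟨
      fromℤ (a ℤ.* b)                       ∎)
      where
      open ≡-Reasoning
      open ℚ-Solver

    neg-pIntegral : ∀ {q} → PIntegral p q → PIntegral p (- q)
    neg-pIntegral {q} (pIntegral m a p∤m eq) =
      pIntegral m (ℤ.- a) p∤m (trans (sym (neg-distribˡ-* q (fromℕ m))) (trans (cong -_ eq) (sym (fromℤ-neg a))))

    sumTo-pIntegral : ∀ n (f : ℕ → ℚ) → (∀ i → i ≤ n → PIntegral p (f i)) → PIntegral p (sumTo n f)
    sumTo-pIntegral zero    f integral = integral 0 z≤n
    sumTo-pIntegral (suc n) f integral = +-pIntegral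
      (sumTo-pIntegral n f (λ i i≤n → integral i (ℕ.m≤n⇒m≤1+n i≤n))) (integral (suc n) ℕ.≤-refl)

    pIntegral-cancel : ∀ q c → ¬ p ∣ c → PIntegral p (q * fromℕ c) → PIntegral p q
    pIntegral-cancel q c p∤c (pIntegral m a p∤m eq) =
      pIntegral (c ℕ.* m) a (p∤* p∤c p∤m) (trans (cong (q *_) (fromℕ-* c m)) (trans (sym (*-assoc q (fromℕ c) (fromℕ m))) eq))

    pIntegral⇒p∤den : ∀ {q} → PIntegral p q → ¬ p ∣ den q
    pIntegral⇒p∤den {q} (pIntegral m a p∤m eq) p∣den = p∤m (∣-trans p∣den (den-∣ q (ℤ.+ m) a eq))

    p∤den⇒pIntegral : ∀ q → ¬ p ∣ den q → PIntegral p q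
    p∤den⇒pIntegral q p∤den = pIntegral (den q) (↥ q) p∤den (*-den≡↥ q)

    binomial-term-pIntegral : ∀ n i → i ≤ n → ∀ a b → PIntegral p (fromℕ (i !) * a) → PIntegral p (fromℕ ((n ∸ i) !) * b) →
                         PIntegral p (fromℕ (n !) * (a * b))
    binomial-term-pIntegral n i i≤n a b a-integral b-integral with k![n∸k]!∣n! {n} {i} i≤n
    ... | divides C eq = subst (PIntegral p) (sym binomial)
      (*-pIntegral (fromℕ-pIntegral C) (*-pIntegral a-integral b-integral))
      where
      binomial : fromℕ (n !) * (a * b) ≡ fromℕ C * ((fromℕ (i !) * a) * (fromℕ ((n ∸ i) !) * b))
      binomial = trans (cong (λ v → fromℕ v * (a * b)) eq)
        (trans (cong (_* (a * b)) (trans (fromℕ-* C _) (cong (fromℕ C *_) (fromℕ-* (i !) ((n ∸ i) !)))))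
          (solve 5 (λ c x y u v → c :* (x :* y) :* (u :* v) := c :* ((x :* u) :* (y :* v))) refl
            (fromℕ C) (fromℕ (i !)) (fromℕ ((n ∸ i) !)) a b))
        where open ℚ-Solver

    egfCoeff-expS+1-pIntegral : ∀ j → PIntegral p (egfCoeff (addS expS oneS) j)
    egfCoeff-expS+1-pIntegral j = subst (PIntegral p) (sym (trans (*-distribˡ-+ (fromℕ (j !)) (invFact j) (oneS j))
      (cong (_+ fromℕ (j !) * oneS j) (n!*invFact≡1 j))))
      (+-pIntegral (fromℕ-pIntegral 1) (*-pIntegral (fromℕ-pIntegral (j !)) (oneS-pIntegral j)))
      where
      oneS-pIntegral : ∀ k → PIntegral p (oneS k)
      oneS-pIntegral zero    = fromℕ-pIntegral 1
      oneS-pIntegral (suc k) = fromℕ-pIntegral 0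

    egfCoeff-2tS-pIntegral : ∀ n → PIntegral p (egfCoeff (mulS (constS (fromℕ 2)) tS) n)
    egfCoeff-2tS-pIntegral n = subst (PIntegral p) (cong (fromℕ (n !) *_) (sym (mulS-constS (fromℕ 2) tS n)))
      (*-pIntegral (fromℕ-pIntegral (n !)) (*-pIntegral (fromℕ-pIntegral 2) (tS-pIntegral n)))
      where
      tS-pIntegral : ∀ k → PIntegral p (tS k)
      tS-pIntegral zero          = fromℕ-pIntegral 0
      tS-pIntegral (suc zero)    = fromℕ-pIntegral 1
      tS-pIntegral (suc (suc k)) = fromℕ-pIntegral 0

    -- (e^t + 1) G = 2t and e^t + 1 has constant term 2, so 2 G_N is an integral combination of the G_i, i < N.
    genocchi-pIntegral : ¬ p ∣ 2 → ∀ n → PIntegral p (egfCoeff genocchiS n)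
    genocchi-pIntegral p∤2 n = go n n ℕ.≤-refl
      where
      G : ℕ → ℚ
      G = egfCoeff genocchiS
      go : ∀ bound k → k ≤ bound → PIntegral p (G k)
      go bound zero _ = pIntegral-cancel (G 0) 2 p∤2 (subst (PIntegral p)
        (trans (cong (fromℕ 1 *_) (sym (genocchiS*[expS+1] 0))) (sym (*-assoc (fromℕ 1) (genocchiS 0) (fromℕ 2))))
        (egfCoeff-2tS-pIntegral 0))
      go (suc bound) (suc m) (s≤s m≤b) = pIntegral-cancel (G N) 2 p∤2 (subst (PIntegral p) eq
        (+-pIntegral (egfCoeff-2tS-pIntegral N) (neg-pIntegral lower-terms)))
        where
        N = suc m
        S = sumTo m (λ i → genocchiS i * addS expS oneS (N ∸ i))
        lower-terms : PIntegral p (fromℕ (N !) * S)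
        lower-terms = subst (PIntegral p) (sym (sumTo-*ˡ m (fromℕ (N !)) _)) (sumTo-pIntegral m _ (λ i i≤m →
          binomial-term-pIntegral N i (ℕ.m≤n⇒m≤1+n i≤m) (genocchiS i) (addS expS oneS (N ∸ i))
            (go bound i (ℕ.≤-trans i≤m m≤b)) (egfCoeff-expS+1-pIntegral (N ∸ i))))
        eq : fromℕ (N !) * mulS (constS (fromℕ 2)) tS N - fromℕ (N !) * S ≡ G N * fromℕ 2
        eq = begin
          fromℕ (N !) * mulS (constS (fromℕ 2)) tS N - fromℕ (N !) * S
            ≡⟨ cong (λ v → fromℕ (N !) * v - fromℕ (N !) * S) (sym (genocchiS*[expS+1] N)) ⟩
          fromℕ (N !) * (S + genocchiS N * addS expS oneS (N ∸ N)) - fromℕ (N !) * S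
            ≡⟨ cong (λ k → fromℕ (N !) * (S + genocchiS N * addS expS oneS k) - fromℕ (N !) * S) (ℕ.n∸n≡0 N) ⟩
          fromℕ (N !) * (S + genocchiS N * fromℕ 2) - fromℕ (N !) * S
            ≡⟨ solve 4 (λ f s g t → f :* (s :+ g :* t) :- f :* s := f :* g :* t) refl (fromℕ (N !)) S (genocchiS N) (fromℕ 2) ⟩
          G N * fromℕ 2 ∎
          where
          open ≡-Reasoning
          open ℚ-Solver

    -- For composite k + 1 this rests on (k + 1) ∣ 2 · k!, for k + 1 = p the factor p cancels.
    p*k!/[k+1]-pIntegral : ¬ p ∣ 2 → ∀ k → PIntegral p (fromℕ p * fromℕ (k !) * 1/[1+ k ])
    p*k!/[k+1]-pIntegral p∤2 zero = *-pIntegral (*-pIntegral (fromℕ-pIntegral p) (fromℕ-pIntegral 1)) (fromℕ-pIntegral 1)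
    p*k!/[k+1]-pIntegral p∤2 k@(suc _) with prime? (suc k)
    ... | no ¬prime = subst (PIntegral p) (sym (*-assoc (fromℕ p) (fromℕ (k !)) 1/[1+ k ]))
      (*-pIntegral (fromℕ-pIntegral p) (pIntegral-cancel (fromℕ (k !) * 1/[1+ k ]) 2 p∤2
        (subst (PIntegral p) (sym k!/[k+1]*2≡j) (fromℕ-pIntegral j))))
      where
      [k+1]∣2*k! = composite-∣-2*! k (¬prime⇒composite {suc k} {{ℕ.nonTrivial}} ¬prime)
      j = quotient [k+1]∣2*k!
      k!/[k+1]*2≡j : fromℕ (k !) * 1/[1+ k ] * fromℕ 2 ≡ fromℕ j
      k!/[k+1]*2≡j = begin
        fromℕ (k !) * 1/[1+ k ] * fromℕ 2           ≡⟨ solve 3 (λ a b c → a :* b :* c := c :* a :* b) refl (fromℕ (k !)) 1/[1+ k ] (fromℕ 2) ⟩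
        fromℕ 2 * fromℕ (k !) * 1/[1+ k ]           ≡⟨ cong (_* 1/[1+ k ]) (fromℕ-* 2 (k !)) ⟨
        fromℕ (2 ℕ.* k !) * 1/[1+ k ]               ≡⟨ cong (λ v → fromℕ v * 1/[1+ k ]) (m∣n⇒n≡quotient*m [k+1]∣2*k!) ⟩
        fromℕ (j ℕ.* suc k) * 1/[1+ k ]             ≡⟨ cong (_* 1/[1+ k ]) (fromℕ-* j (suc k)) ⟩
        fromℕ j * fromℕ (suc k) * 1/[1+ k ]         ≡⟨ *-assoc (fromℕ j) _ _ ⟩
        fromℕ j * (fromℕ (suc k) * 1/[1+ k ])       ≡⟨ cong (fromℕ j *_) (fromℕ-suc*1/[1+n] k) ⟩
        fromℕ j * 1ℚ                                ≡⟨ *-identityʳ _ ⟩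
        fromℕ j                                     ∎
        where
        open ≡-Reasoning
        open ℚ-Solver
    ... | yes prime-1+k with suc k ℕ.≟ p
    ...   | yes refl = subst (PIntegral p) (sym p*k!/p≡k!) (fromℕ-pIntegral (k !))
      where
      p*k!/p≡k! : fromℕ (suc k) * fromℕ (k !) * 1/[1+ k ] ≡ fromℕ (k !)
      p*k!/p≡k! = trans (solve 3 (λ a b c → a :* b :* c := b :* (a :* c)) refl (fromℕ (suc k)) (fromℕ (k !)) 1/[1+ k ])
        (trans (cong (fromℕ (k !) *_) (fromℕ-suc*1/[1+n] k)) (*-identityʳ _))
        where open ℚ-Solver
    ...   | no 1+k≢p = *-pIntegral (*-pIntegral (fromℕ-pIntegral p) (fromℕ-pIntegral (k !))) 1/[1+k]-pIntegral
      where
      p∤1+k : ¬ p ∣ suc k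
      p∤1+k p∣1+k with prime⇒irreducible prime-1+k p∣1+k
      ... | inj₁ p≡1   = ¬prime[1] (subst Prime p≡1 p-prime)
      ... | inj₂ p≡1+k = 1+k≢p (sym p≡1+k)
      1/[1+k]-pIntegral : PIntegral p 1/[1+ k ]
      1/[1+k]-pIntegral = pIntegral (suc k) (ℤ.+ 1) p∤1+k (trans (*-comm 1/[1+ k ] _) (fromℕ-suc*1/[1+n] k))

    sgn-pIntegral : ∀ k → PIntegral p (sgn k)
    sgn-pIntegral zero    = fromℕ-pIntegral 1
    sgn-pIntegral (suc k) = *-pIntegral (neg-pIntegral (fromℕ-pIntegral 1)) (sgn-pIntegral k)

    -- B_N = Σ_k (-1)^k k! S(N, k) / (k + 1), and each p k! / (k + 1) is p-integral.
    p*bernoulli-pIntegral : ¬ p ∣ 2 → ∀ N → PIntegral p (fromℕ p * bernoulli N)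
    p*bernoulli-pIntegral p∤2 N = subst (PIntegral p) (sym expand) (sumTo-pIntegral N F (λ k _ → term k))
      where
      F : ℕ → ℚ
      F k = fromℕ p * (fromℕ (N !) * (log1p/xS k * powS expm1S k N))
      expand : fromℕ p * bernoulli N ≡ sumTo N F
      expand = begin
        fromℕ p * (fromℕ (N !) * bernoulliS N)                              ≡⟨ cong (λ v → fromℕ p * (fromℕ (N !) * v)) (bernoulliS≈log1p/xS∘expm1S N) ⟩
        fromℕ p * (fromℕ (N !) * sumTo N (λ k → log1p/xS k * powS expm1S k N)) ≡⟨ cong (fromℕ p *_) (sumTo-*ˡ N (fromℕ (N !)) _) ⟩
        fromℕ p * sumTo N (λ k → fromℕ (N !) * (log1p/xS k * powS expm1S k N)) ≡⟨ sumTo-*ˡ N (fromℕ p) _ ⟩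
        sumTo N F                                                           ∎
        where open ≡-Reasoning
      term : ∀ k → PIntegral p (F k)
      term k with stirling-integrality N k
      ... | z , eq = subst (PIntegral p) (sym regroup)
        (*-pIntegral (*-pIntegral (sgn-pIntegral k) (p*k!/[k+1]-pIntegral p∤2 k)) (fromℤ-pIntegral z))
        where
        regroup : F k ≡ sgn k * (fromℕ p * fromℕ (k !) * 1/[1+ k ]) * fromℤ z
        regroup = begin
          fromℕ p * (fromℕ (N !) * (sgn k * 1/[1+ k ] * powS expm1S k N))
            ≡⟨ solve 5 (λ a b s r x → a :* (b :* (s :* r :* x)) := s :* (a :* r) :* (b :* x)) refl
                 (fromℕ p) (fromℕ (N !)) (sgn k) 1/[1+ k ] (powS expm1S k N) ⟩
          sgn k * (fromℕ p * 1/[1+ k ]) * (fromℕ (N !) * powS expm1S k N)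
            ≡⟨ cong (sgn k * (fromℕ p * 1/[1+ k ]) *_) eq ⟩
          sgn k * (fromℕ p * 1/[1+ k ]) * (fromℕ (k !) * fromℤ z)
            ≡⟨ solve 5 (λ s a r f z → s :* (a :* r) :* (f :* z) := s :* (a :* f :* r) :* z) refl
                 (sgn k) (fromℕ p) 1/[1+ k ] (fromℕ (k !)) (fromℤ z) ⟩
          sgn k * (fromℕ p * fromℕ (k !) * 1/[1+ k ]) * fromℤ z ∎
          where
          open ≡-Reasoning
          open ℚ-Solver

    p∤2^ : ¬ p ∣ 2 → ∀ k → ¬ p ∣ 2 ^ k
    p∤2^ p∤2 zero    = p∤1
    p∤2^ p∤2 (suc k) = p∤* p∤2 (p∤2^ p∤2 k)

    p²∤den : ∀ x → PIntegral p (fromℕ p * x) → ¬ p ℕ.* p ∣ den x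
    p²∤den x (pIntegral m a p∤m eq) p²∣den =
      p∤m (*-cancelˡ-∣ p {{prime⇒nonZero p-prime}} (∣-trans p²∣den (den-∣ x (ℤ.+ (p ℕ.* m)) a x*pm≡a)))
      where
      x*pm≡a : x * fromℕ (p ℕ.* m) ≡ fromℤ a
      x*pm≡a = trans (cong (x *_) (fromℕ-* p m))
        (trans (solve 3 (λ a b c → a :* (b :* c) := b :* a :* c) refl x (fromℕ p) (fromℕ m)) eq)
        where open ℚ-Solver

    -- p x being p-integral forces ord_p (den x) ≤ 1, so only whether p divides the denominator matters.
    ord-den-*ℕ : ∀ x c → PIntegral p (fromℕ p * x) → (p ∣ den x → ¬ p ∣ c) → ord p (den (x * fromℕ c)) ≡ ord p (den x)
    ord-den-*ℕ x c px-integral p∤c with p ∣? den x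
    ... | no p∤den = trans (ord-≡0 p _ (pIntegral⇒p∤den (*-pIntegral (p∤den⇒pIntegral x p∤den) (fromℕ-pIntegral c))))
                           (sym (ord-≡0 p _ p∤den))
    ... | yes p∣den = trans (ord-≡1 p-prime p∣den[y] (λ p²∣ → p²∤den x px-integral (∣-trans p²∣ den[y]∣den[x])))
                            (sym (ord-≡1 p-prime p∣den (p²∤den x px-integral)))
      where
      open ℚ-Solver
      y = x * fromℕ c
      den[y]∣den[x] : den y ∣ den x
      den[y]∣den[x] = den-∣ y (ℤ.+ den x) (ℤ.+ c ℤ.* ↥ x)
        (trans (solve 3 (λ a b c → a :* b :* c := b :* (a :* c)) refl x (fromℕ c) (fromℕ (den x)))
          (trans (cong (fromℕ c *_) (*-den≡↥ x)) (sym (fromℤ-* (ℤ.+ c) (↥ x)))))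
      den[x]∣c*den[y] : den x ∣ c ℕ.* den y
      den[x]∣c*den[y] = den-∣ x (ℤ.+ (c ℕ.* den y)) (↥ y)
        (trans (cong (x *_) (fromℕ-* c (den y))) (trans (sym (*-assoc x (fromℕ c) (fromℕ (den y)))) (*-den≡↥ y)))
      p∣den[y] : p ∣ den y
      p∣den[y] = [ (λ p∣c → ⊥-elim (p∤c p∣den p∣c)) , (λ p∣den[y] → p∣den[y]) ]′
        (euclidsLemma c (den y) p-prime (∣-trans p∣den den[x]∣c*den[y]))

    p∣den⇒p∣ : ∀ x m → PIntegral p (x * fromℕ m) → p ∣ den x → p ∣ m
    p∣den⇒p∣ x m xm-integral p∣den with p ∣? m
    ... | yes p∣m = p∣m
    ... | no  p∤m = ⊥-elim (pIntegral⇒p∤den (pIntegral-cancel x m p∤m xm-integral) p∣den)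

    ord-den-polycotangent : ¬ p ∣ 2 → ∀ N → 2 ≤ N → ord p (den (polycotangent (ℤ.+ 1) N)) ≡ ord p (den (bernoulli N))
    ord-den-polycotangent p∤2 N 2≤N =
      trans (cong (λ q → ord p (den q)) (trans (polycotangent≡ N 2≤N) (cong (bernoulli N *_) (fromℕ-2^ N))))
        (ord-den-*ℕ (bernoulli N) (2 ^ N) (p*bernoulli-pIntegral p∤2 N) (λ _ → p∤2^ p∤2 N))

    ord-den-polycosecant : ¬ p ∣ 2 → ∀ N → 1 ≤ N → ord p (den (polycosecant (ℤ.+ 1) N)) ≡ ord p (den (bernoulli N))
    ord-den-polycosecant p∤2 N 1≤N = begin
      ord p (den (polycosecant (ℤ.+ 1) N))  ≡⟨ cong (λ q → ord p (den q)) (polycosecant≡-bernoulli*[2^∸2] N 1≤N) ⟩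
      ord p (den (- (x * fromℕ a)))         ≡⟨ cong (ord p) (den-neg (x * fromℕ a)) ⟩
      ord p (den (x * fromℕ a))             ≡⟨ ord-den-*ℕ x a (p*bernoulli-pIntegral p∤2 N) p∤a ⟩
      ord p (den x)                         ∎
      where
      open ≡-Reasoning
      x = bernoulli N
      a = 2 ^ N ∸ 2
      -- The Genocchi number 2 (1 - 2^N) B_N is p-integral, so p ∣ den x forces p ∣ 2^N - 1.
      p∣den⇒p∣1+a : p ∣ den x → p ∣ suc a
      p∣den⇒p∣1+a p∣den = [ (λ p∣2 → ⊥-elim (p∤2 p∣2)) , (λ p∣1+a → p∣1+a) ]′
        (euclidsLemma 2 (suc a) p-prime (p∣den⇒p∣ x (2 ℕ.* suc a)
          (subst (PIntegral p) (neg-genocchi≡bernoulli*2[1+[2^∸2]] N 1≤N) (neg-pIntegral (genocchi-pIntegral p∤2 N))) p∣den))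
      p∤a : p ∣ den x → ¬ p ∣ a
      p∤a p∣den p∣a = p∤1 (∣m+n∣m⇒∣n (subst (p ∣_) (ℕ.+-comm 1 a) (p∣den⇒p∣1+a p∣den)) p∣a)

  odd-prime∤2 : ∀ {p} → Prime p → p % 2 ≡ 1 → ¬ p ∣ 2
  odd-prime∤2 {zero}              p-prime _  _   = ¬prime[0] p-prime
  odd-prime∤2 {suc zero}          p-prime _  _   = ¬prime[1] p-prime
  odd-prime∤2 {suc (suc zero)}    _       () _
  odd-prime∤2 {suc (suc (suc _))} _       _  p∣2 with ∣⇒≤ p∣2
  ... | s≤s (s≤s ())

open import Data.Nat using (ℕ; _*_; _%_; _≥_)
open import Data.Nat.Properties using (*-monoʳ-≤; ≤-trans; m≤n*m)
open import Data.Nat.Primality using (Prime)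
open import Data.Integer using (+_)
open import Data.Product using (_×_; _,_)
open import Relation.Binary.PropositionalEquality using (_≡_; trans; sym)

proposition3p20 : (p : ℕ) → Prime p → p % 2 ≡ 1 → (n : ℕ) → n ≥ 1 →
    (ord p (den (polycosecant (+ 1) (2 * n))) ≡ ord p (den (polycotangent (+ 1) (2 * n))))
    × (ord p (den (polycotangent (+ 1) (2 * n))) ≡ ord p (den (bernoulli (2 * n))))
proposition3p20 p p-prime p-odd n n≥1 = trans ord-D (sym ord-D̂) , ord-D̂
  where
  p∤2 = odd-prime∤2 p-prime p-odd
  ord-D̂ = ord-den-polycotangent p-prime p∤2 (2 * n) (*-monoʳ-≤ 2 n≥1)
  ord-D  = ord-den-polycosecant p-prime p∤2 (2 * n) (≤-trans n≥1 (m≤n*m n 2))
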